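{- Let $M=L(G,\mathcal{B})$ where $G\in\mathcal{G}$ has at least five vertices and $\mathcal{B}$ is a linear class of Hamiltonian cycles of $G$. If $C$ is a circuit-hyperplane of $M$, then $G[C]$ is a cycle in $\mathcal{B}$.
   Context: Graphs may have loops and parallel edges. A theta-subgraph consists of two distinct vertices $u,v$ and three internally vertex-disjoint $u$–$v$ paths. A linear class is a collection $\mathcal{B}$ of cycles of a graph such that no theta-subgraph contains exactly two cycles of $\mathcal{B}$; cycles in $\mathcal{B}$ are balanced, others unbalanced. The lift matroid $L(G,\mathcal{B})$ on $E(G)$ has as circuits the edge-sets of balanced cycles, of theta-subgraphs containing an unbalanced cycle, and of unions of two unbalanced cycles sharing at most one vertex. $\mathcal{G}$ is the class of graphs consisting of: all graphs with a single vertex; all connected graphs with exactly two vertices and at most four edges joining them; all graphs whose underlying simple graph is a cycle on at least three vertices and in which every parallel class has at most two edges (loops allowed). -}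

module Defs where

open import Data.Nat using (ℕ; zero; suc; _≤_; _<_)
open import Data.Fin using (Fin; zero; suc; fromℕ; inject₁)
open import Data.Fin.Subset using (Subset; _∈_; _∉_; _⊆_; _∪_; ⁅_⁆; ∣_∣; ⊤)
open import Data.Product using (Σ; _×_; _,_; ∃; ∃-syntax; proj₁; proj₂)
open import Data.Sum using (_⊎_)
open import Relation.Nullary using (¬_)
open import Relation.Binary.PropositionalEquality using (_≡_; _≢_)
open import Function.Bundles using (_⇔_)

-- A graph (loops and parallel edges allowed) with vertex set Fin n and
-- edge set Fin m is given by  ends : Fin m → Fin n × Fin n  (unordered reading).
-- Edge sets are  Subset m.

module _ {n m : ℕ} (ends : Fin m → Fin n × Fin n) where

  Joins : Fin m → Fin n → Fin n → Set
  Joins e u v = (ends e ≡ (u , v)) ⊎ (ends e ≡ (v , u))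

  Incident : Fin m → Fin n → Set
  Incident e x = (proj₁ (ends e) ≡ x) ⊎ (proj₂ (ends e) ≡ x)

  VertexOf : Subset m → Fin n → Set
  VertexOf X x = ∃[ f ] (f ∈ X × Incident f x)

  -- X is the edge set of a cycle: a closed walk  w 0, e 0, w 1, ..., e k, w (k+1) = w 0
  -- of length k+1 ≥ 1 with distinct vertices w 0 … w k and distinct edges.
  IsCycle : Subset m → Set
  IsCycle X =
    Σ ℕ λ k →
    Σ (Fin (suc (suc k)) → Fin n) λ w →
    Σ (Fin (suc k) → Fin m) λ e →
      (w zero ≡ w (fromℕ (suc k)))
    × (∀ i j → w (inject₁ i) ≡ w (inject₁ j) → i ≡ j)
    × (∀ i j → e i ≡ e j → i ≡ j)
    × (∀ i → Joins (e i) (w (inject₁ i)) (w (suc i)))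
    × (∀ f → (f ∈ X) ⇔ (∃[ i ] (e i ≡ f)))

  IsHamiltonianCycle : Subset m → Set
  IsHamiltonianCycle X = IsCycle X × (∀ x → VertexOf X x)

  record Path (u v : Fin n) : Set where
    field
      len   : ℕ
      vtx   : Fin (suc len) → Fin n
      edg   : Fin len → Fin m
      start : vtx zero ≡ u
      end   : vtx (fromℕ len) ≡ v
      vinj  : ∀ i j → vtx i ≡ vtx j → i ≡ j
      einj  : ∀ i j → edg i ≡ edg j → i ≡ j
      step  : ∀ i → Joins (edg i) (vtx (inject₁ i)) (vtx (suc i))

  open Path

  OnPathV : ∀ {u v} → Path u v → Fin n → Set
  OnPathV P x = ∃[ i ] (vtx P i ≡ x)

  OnPathE : ∀ {u v} → Path u v → Fin m → Set
  OnPathE P f = ∃[ i ] (edg P i ≡ f)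

  IntDisjoint : ∀ {u v} → Path u v → Path u v → Set
  IntDisjoint {u} {v} P Q =
      (∀ f → OnPathE P f → ¬ OnPathE Q f)
    × (∀ x → OnPathV P x → OnPathV Q x → (x ≡ u) ⊎ (x ≡ v))

  IsTheta : Subset m → Set
  IsTheta X =
    Σ (Fin n) λ u → Σ (Fin n) λ v →
    Σ (Path u v) λ P₁ → Σ (Path u v) λ P₂ → Σ (Path u v) λ P₃ →
      (u ≢ v)
    × IntDisjoint P₁ P₂ × IntDisjoint P₁ P₃ × IntDisjoint P₂ P₃
    × (∀ f → (f ∈ X) ⇔ (OnPathE P₁ f ⊎ OnPathE P₂ f ⊎ OnPathE P₃ f))

  IsLinearClass : (Subset m → Set) → Set
  IsLinearClass B =
      (∀ X → B X → IsCycle X)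
    × (∀ T → IsTheta T →
         ¬ (Σ (Subset m) λ X → Σ (Subset m) λ Y →
              X ≢ Y
            × IsCycle X × X ⊆ T × B X
            × IsCycle Y × Y ⊆ T × B Y
            × (∀ Z → IsCycle Z → Z ⊆ T → B Z → (Z ≡ X) ⊎ (Z ≡ Y))))

  module _ (B : Subset m → Set) where

    Unbalanced : Subset m → Set
    Unbalanced X = IsCycle X × ¬ B X

    LiftFamily : Subset m → Set
    LiftFamily X =
        (IsCycle X × B X)
      ⊎ (IsTheta X × ∃[ Y ] (Y ⊆ X × Unbalanced Y))
      ⊎ (Σ (Subset m) λ X₁ → Σ (Subset m) λ X₂ →
            Unbalanced X₁ × Unbalanced X₂ × X₁ ≢ X₂
          × (∀ x y → VertexOf X₁ x → VertexOf X₂ x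
                   → VertexOf X₁ y → VertexOf X₂ y → x ≡ y)
          × X ≡ X₁ ∪ X₂)

    LiftCircuit : Subset m → Set
    LiftCircuit X = LiftFamily X × (∀ Y → LiftFamily Y → Y ⊆ X → Y ≡ X)

    Independent : Subset m → Set
    Independent I = ∀ C → LiftCircuit C → ¬ (C ⊆ I)

    IsRank : Subset m → ℕ → Set
    IsRank X r =
      Σ (Subset m) λ I → I ⊆ X × Independent I × ∣ I ∣ ≡ r
        × (∀ J → J ⊆ X → Independent J → ∣ J ∣ ≤ r)

    IsFlat : Subset m → Set
    IsFlat X = ∀ e → e ∉ X → ∀ r s → IsRank X r → IsRank (X ∪ ⁅ e ⁆) s → r < s

    IsHyperplane : Subset m → Set
    IsHyperplane H = IsFlat H × (∀ r h → IsRank ⊤ r → IsRank H h → suc h ≡ r)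

    IsCircuitHyperplane : Subset m → Set
    IsCircuitHyperplane C = LiftCircuit C × IsHyperplane C

  -- membership in the class 𝒢 for graphs with at least three vertices:
  -- the underlying simple graph is a cycle on all n vertices (given by a
  -- cyclic ordering w 0, …, w (n-1), w n = w 0), and every parallel class
  -- has at most two edges.
  Adjacent : Fin n → Fin n → Set
  Adjacent u v = ∃[ e ] Joins e u v

  Parallel : Fin m → Fin m → Set
  Parallel e f = Joins f (proj₁ (ends e)) (proj₂ (ends e))

  UnderlyingSimpleIsCycle : Set
  UnderlyingSimpleIsCycle =
    Σ (Fin (suc n) → Fin n) λ w →
      (w zero ≡ w (fromℕ n))
    × (∀ i j → w (inject₁ i) ≡ w (inject₁ j) → i ≡ j)
    × (∀ u v → u ≢ v →
         Adjacent u v ⇔ (∃[ i ] (((w (inject₁ i) ≡ u) × (w (suc i) ≡ v))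
                               ⊎ ((w (inject₁ i) ≡ v) × (w (suc i) ≡ u)))))

  ParallelClassesAtMostTwo : Set
  ParallelClassesAtMostTwo =
    ∀ e f g → Parallel e f → Parallel e g → (e ≡ f) ⊎ (e ≡ g) ⊎ (f ≡ g)

  InClassGAtLeast3 : Set
  InClassGAtLeast3 = UnderlyingSimpleIsCycle × ParallelClassesAtMostTwo

-- If C is a circuit-hyperplane and e ∉ C, then C − y + e is independent for some y ∈ C, and no
-- independent set has more than |C| elements.  In G every cycle with at least three edges is
-- Hamiltonian, and so is every balanced cycle.  Hence a theta circuit is a long cycle plus an edge
-- parallel to one of its edges, and a handcuff either consists of a long cycle and a loop or has at
-- most four edges.  In the first two cases, for all e ∉ C and y ∈ C, a member of the circuit family
-- (a rerouted cycle, a theta, or a handcuff of a cycle or digon with a loop) lies in C − y + e; in the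
-- last, a Hamiltonian path plus a loop or a parallel edge is an independent set with n + 1 > 4
-- elements.  So only a balanced cycle can be a circuit-hyperplane.

module Submission where

open import Defs
open import Data.Bool using (true; false)
import Data.Bool.Properties as Bool
open import Data.Empty using (⊥; ⊥-elim)
open import Data.Fin using (Fin; zero; suc; fromℕ; inject₁; toℕ; punchOut)
open import Data.Fin.Induction using (>-weakInduction)
import Data.Fin.Properties as Fin
open import Data.Fin.Subset renaming (⊥ to ∅)
open import Data.Fin.Subset.Properties
open import Data.Nat using (ℕ; zero; suc; _+_; _∸_; _≤_; _<_; z≤n; s≤s; _≤?_)
open import Data.Nat.GeneralisedArithmetic using (fold; fold-+)
open import Data.Nat.Induction using (<-wellFounded)
import Data.Nat.Properties
open import Data.Nat.Properties using (+-comm; +-suc; +-monoʳ-≤; +-mono-≤; m+[n∸m]≡n; suc-injective; 0≢1+n; 1+n≰n; n≤1+n; ≤-reflexive; ≤-trans; ≤-pred; <⇒≱; ≰⇒>; m≤n⇒m<n∨m≡n)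
open import Data.Product using (Σ; _×_; _,_; proj₁; proj₂; ∃; ∃₂; ∃-syntax)
open import Data.Sum using (_⊎_; inj₁; inj₂; [_,_]′)
import Data.Unit as Unit
open import Data.Vec using ([]; _∷_; here; there; tabulate)
import Data.Vec.Properties as Vec
open import Function.Base using (case_of_)
open import Function.Bundles using (Equivalence; _⇔_; mk⇔)
open import Induction.WellFounded using (Acc; acc)
open import Relation.Binary.PropositionalEquality
open import Relation.Nullary using (¬_; Dec; yes; no)
open import Relation.Nullary.Decidable using (⌊_⌋; ¬?; _×-dec_; decidable-stable; ¬¬-excluded-middle)
open import Relation.Nullary.Negation using (contradiction)

open Equivalence

-- Cyclic order on Fin (suc k)

data LastView : {k : ℕ} → Fin (suc k) → Set where
  last  : ∀ {k} → LastView (fromℕ k)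
  inner : ∀ {k} (j : Fin k) → LastView (inject₁ j)

lastView : ∀ {k} (i : Fin (suc k)) → LastView i
lastView {zero} zero = last
lastView {suc k} zero = inner zero
lastView {suc k} (suc i) with lastView i
... | last = last
... | inner j = inner (suc j)

lastView-fromℕ : ∀ k → lastView (fromℕ k) ≡ last
lastView-fromℕ zero = refl
lastView-fromℕ (suc k) rewrite lastView-fromℕ k = refl

lastView-inject₁ : ∀ {k} (j : Fin k) → lastView (inject₁ j) ≡ inner j
lastView-inject₁ {suc k} zero = refl
lastView-inject₁ {suc k} (suc j) rewrite lastView-inject₁ j = refl

next : ∀ {k} → Fin (suc k) → Fin (suc k)
next i with lastView i
... | last = zero
... | inner j = suc j

prev : ∀ {k} → Fin (suc k) → Fin (suc k)
prev {k} zero = fromℕ k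
prev (suc j) = inject₁ j

next-fromℕ : ∀ k → next (fromℕ k) ≡ zero
next-fromℕ k rewrite lastView-fromℕ k = refl

next-inject₁ : ∀ {k} (j : Fin k) → next (inject₁ j) ≡ suc j
next-inject₁ j rewrite lastView-inject₁ j = refl

next-prev : ∀ {k} (i : Fin (suc k)) → next (prev i) ≡ i
next-prev {k} zero = next-fromℕ k
next-prev (suc j) = next-inject₁ j

next-injective : ∀ {k} {i j : Fin (suc k)} → next i ≡ next j → i ≡ j
next-injective {i = i} {j} eq with lastView i | lastView j | eq
... | last    | last    | _ = refl
... | inner a | inner b | e = cong inject₁ (Fin.suc-injective e)

inject₁≢suc : ∀ {k} (i : Fin k) → inject₁ i ≢ suc i
inject₁≢suc zero ()
inject₁≢suc (suc i) e = inject₁≢suc i (Fin.suc-injective e)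

next≢id : ∀ {k} → 1 ≤ k → (t : Fin (suc k)) → next t ≢ t
next≢id (s≤s z≤n) t e with lastView t | e
... | inner j | e′ = inject₁≢suc j (sym e′)

next²≢id : ∀ {k} → 2 ≤ k → (t : Fin (suc k)) → next (next t) ≢ t
next²≢id (s≤s (s≤s z≤n)) t e with lastView t
... | last with e
... | ()
next²≢id (s≤s (s≤s z≤n)) t e | inner j with lastView j
... | last with e
... | ()
next²≢id (s≤s (s≤s z≤n)) t e | inner j | inner i = lemma i e
  where
  lemma : ∀ {k} (i : Fin k) → suc (suc i) ≢ inject₁ (inject₁ i)
  lemma zero ()
  lemma (suc i) e = lemma i (Fin.suc-injective e)

fold-comm : ∀ {A : Set} (f : A → A) d x → fold (f x) f d ≡ f (fold x f d)
fold-comm f zero x = refl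
fold-comm f (suc d) x = cong f (fold-comm f d x)

fold-injective : ∀ {A : Set} (f : A → A) → (∀ {x y} → f x ≡ f y → x ≡ y) →
                 ∀ d {x y} → fold x f d ≡ fold y f d → x ≡ y
fold-injective f f-inj zero e = e
fold-injective f f-inj (suc d) e = fold-injective f f-inj d (f-inj e)

fold-next-zero : ∀ {k} (t : Fin (suc k)) → fold zero next (toℕ t) ≡ t
fold-next-zero {k} t = go (toℕ t) t refl
  where
  go : ∀ d (t : Fin (suc k)) → toℕ t ≡ d → fold zero next d ≡ t
  go zero zero _ = refl
  go (suc d) (suc j) e =
    trans (cong next (go d (inject₁ j) (trans (Fin.toℕ-inject₁ j) (suc-injective e)))) (next-inject₁ j)

fold-next-cycle : ∀ k → fold (zero {k}) next (suc k) ≡ zero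
fold-next-cycle k = begin
  next (fold zero next k)                  ≡⟨ cong (λ d → next (fold zero next d)) (sym (Fin.toℕ-fromℕ k)) ⟩
  next (fold zero next (toℕ (fromℕ k)))    ≡⟨ cong next (fold-next-zero (fromℕ k)) ⟩
  next (fromℕ k)                           ≡⟨ next-fromℕ k ⟩
  zero                                     ∎
  where open ≡-Reasoning

next-reaches : ∀ {k} (i t : Fin (suc k)) → ∃ λ d → fold i next d ≡ t
next-reaches {k} i t = toℕ t + r , (begin
  fold i next (toℕ t + r)                ≡⟨ fold-+ i next (toℕ t) ⟩
  fold (fold i next r) next (toℕ t)      ≡⟨ cong (λ x → fold x next (toℕ t)) to-zero ⟩
  fold zero next (toℕ t)                 ≡⟨ fold-next-zero t ⟩
  t                                      ∎)
  where
  open ≡-Reasoning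
  r = suc k ∸ toℕ i
  to-zero : fold i next r ≡ zero
  to-zero = begin
    fold i next r                        ≡⟨ cong (λ x → fold x next r) (sym (fold-next-zero i)) ⟩
    fold (fold zero next (toℕ i)) next r ≡⟨ sym (fold-+ zero next r) ⟩
    fold zero next (r + toℕ i)           ≡⟨ cong (fold zero next) (trans (+-comm r (toℕ i)) (m+[n∸m]≡n (Fin.toℕ≤n i))) ⟩
    fold zero next (suc k)               ≡⟨ fold-next-cycle k ⟩
    zero                                 ∎

next-induction : ∀ {k} (P : Fin (suc k) → Set) → (∀ t → P t → P (next t)) → ∀ i → P i → ∀ t → P t
next-induction P step i pi t with next-reaches i t
... | d , refl = go d
  where
  go : ∀ d → P (fold i next d)
  go zero = pi
  go (suc d) = step _ (go d)

next-backward-induction : ∀ {k} (P : Fin (suc k) → Set) → (∀ t → P (next t) → P t) → ∀ i → P i → ∀ t → P t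
next-backward-induction P step i pi t with next-reaches t i
... | d , refl = go d pi
  where
  go : ∀ {t} d → P (fold t next d) → P t
  go zero p = p
  go (suc d) p = go d (step _ p)

rotate : ∀ {k} → Fin (suc k) → Fin (suc k) → Fin (suc k)
rotate j t = fold (next t) next (toℕ j)

rotate-fromℕ : ∀ {k} (j : Fin (suc k)) → rotate j (fromℕ k) ≡ j
rotate-fromℕ {k} j rewrite next-fromℕ k = fold-next-zero j

rotate-next : ∀ {k} (j t : Fin (suc k)) → rotate j (next t) ≡ next (rotate j t)
rotate-next j t = fold-comm next (toℕ j) (next t)

rotate-injective : ∀ {k} (j : Fin (suc k)) {x y} → rotate j x ≡ rotate j y → x ≡ y
rotate-injective j e = next-injective (fold-injective next next-injective (toℕ j) e)

rotate-zero : ∀ {k} (j : Fin (suc k)) → rotate j zero ≡ next j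
rotate-zero {k} j = begin
  rotate j zero               ≡⟨ cong (rotate j) (sym (next-fromℕ k)) ⟩
  rotate j (next (fromℕ k))   ≡⟨ rotate-next j (fromℕ k) ⟩
  next (rotate j (fromℕ k))   ≡⟨ cong next (rotate-fromℕ j) ⟩
  next j                      ∎
  where open ≡-Reasoning

injective⇒surjective : ∀ {n} (f : Fin n → Fin n) → (∀ {i j} → f i ≡ f j → i ≡ j) → ∀ y → ∃ λ i → f i ≡ y
injective⇒surjective {zero} f f-inj ()
injective⇒surjective {suc n} f f-inj y with Fin.any? (λ i → f i Fin.≟ y)
... | yes found = found
... | no missed = contradiction (Fin.injective⇒≤ g-inj) 1+n≰n
  where
  f≢y : ∀ i → y ≢ f i
  f≢y i e = missed (i , sym e)
  g : Fin (suc n) → Fin n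
  g i = punchOut (f≢y i)
  g-inj : ∀ {i j} → g i ≡ g j → i ≡ j
  g-inj {i} {j} e = f-inj (Fin.punchOut-injective (f≢y i) (f≢y j) e)

surjective⇒≥ : ∀ {a b} (f : Fin a → Fin b) → (∀ y → ∃ λ i → f i ≡ y) → b ≤ a
surjective⇒≥ f surj = Fin.injective⇒≤ {f = λ y → proj₁ (surj y)}
  (λ {x} {y} e → trans (sym (proj₂ (surj x))) (trans (cong f e) (proj₂ (surj y))))

downward-induction : ∀ {k} (G : Fin (suc k) → Set) → (∀ t → (∀ t' → toℕ t' ≡ suc (toℕ t) → G t') → G t) → ∀ t → G t
downward-induction {k} G step = >-weakInduction G (step (fromℕ k) beyondLast)
  (λ i G[suc-i] → step (inject₁ i) λ t' e → subst G (sym (Fin.toℕ-injective (trans e (cong suc (Fin.toℕ-inject₁ i))))) G[suc-i])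
  where
  beyondLast : ∀ t' → toℕ t' ≡ suc (toℕ (fromℕ k)) → G t'
  beyondLast t' e = ⊥-elim (<⇒≱ (Fin.toℕ<n t') (≤-reflexive (sym (trans e (cong suc (Fin.toℕ-fromℕ k))))))

-- Finite subsets

image : ∀ {k m} → (Fin k → Fin m) → Subset m
image f = tabulate (λ y → ⌊ Fin.any? (λ t → f t Fin.≟ y) ⌋)

∈-image⁺ : ∀ {k m} (f : Fin k → Fin m) t → f t ∈ image f
∈-image⁺ f t = Vec.lookup⇒[]= (f t) _ (trans (Vec.lookup∘tabulate _ (f t)) (found (Fin.any? (λ s → f s Fin.≟ f t))))
  where
  found : (d : Dec (∃ λ s → f s ≡ f t)) → ⌊ d ⌋ ≡ true
  found (yes _) = refl
  found (no ¬found) = contradiction (t , refl) ¬found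

∈-image⁻ : ∀ {k m} (f : Fin k → Fin m) {y} → y ∈ image f → ∃ λ t → f t ≡ y
∈-image⁻ f {y} y∈ = witness (Fin.any? (λ t → f t Fin.≟ y)) (trans (sym (Vec.lookup∘tabulate _ y)) (Vec.[]=⇒lookup y∈))
  where
  witness : (d : Dec (∃ λ t → f t ≡ y)) → ⌊ d ⌋ ≡ true → ∃ λ t → f t ≡ y
  witness (yes w) _ = w
  witness (no _) ()

∣p∪q∣≤∣p∣+∣q∣ : ∀ {m} (p q : Subset m) → ∣ p ∪ q ∣ ≤ ∣ p ∣ + ∣ q ∣
∣p∪q∣≤∣p∣+∣q∣ [] [] = z≤n
∣p∪q∣≤∣p∣+∣q∣ (true ∷ p) (true ∷ q) = s≤s (≤-trans (∣p∪q∣≤∣p∣+∣q∣ p q) (+-monoʳ-≤ ∣ p ∣ (n≤1+n ∣ q ∣)))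
∣p∪q∣≤∣p∣+∣q∣ (true ∷ p) (false ∷ q) = s≤s (∣p∪q∣≤∣p∣+∣q∣ p q)
∣p∪q∣≤∣p∣+∣q∣ (false ∷ p) (true ∷ q) = ≤-trans (s≤s (∣p∪q∣≤∣p∣+∣q∣ p q)) (≤-reflexive (sym (+-suc _ _)))
∣p∪q∣≤∣p∣+∣q∣ (false ∷ p) (false ∷ q) = ∣p∪q∣≤∣p∣+∣q∣ p q

∣p∪⁅x⁆∣≤1+∣p∣ : ∀ {m} (p : Subset m) x → ∣ p ∪ ⁅ x ⁆ ∣ ≤ suc ∣ p ∣
∣p∪⁅x⁆∣≤1+∣p∣ p x = ≤-trans (∣p∪q∣≤∣p∣+∣q∣ p ⁅ x ⁆)
  (≤-reflexive (trans (cong (∣ p ∣ +_) (∣⁅x⁆∣≡1 x)) (+-comm ∣ p ∣ 1)))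

p⊆p-x∪⁅x⁆ : ∀ {m} (p : Subset m) x → p ⊆ (p - x) ∪ ⁅ x ⁆
p⊆p-x∪⁅x⁆ p x {y} y∈ with y Fin.≟ x
... | yes refl = x∈p∪q⁺ (inj₂ (x∈⁅x⁆ x))
... | no y≢x = x∈p∪q⁺ (inj₁ (x∈p∧x≢y⇒x∈p-y y∈ y≢x))

∣p∣≤1+∣p-x∣ : ∀ {m} (p : Subset m) x → ∣ p ∣ ≤ suc ∣ p - x ∣
∣p∣≤1+∣p-x∣ p x = ≤-trans (p⊆q⇒∣p∣≤∣q∣ (p⊆p-x∪⁅x⁆ p x)) (∣p∪⁅x⁆∣≤1+∣p∣ (p - x) x)

x∈p─q⇒x∉q : ∀ {m} (p q : Subset m) {x} → x ∈ p ─ q → x ∉ q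
x∈p─q⇒x∉q (_ ∷ p) (true ∷ q) {zero} () here
x∈p─q⇒x∉q (_ ∷ p) (false ∷ q) {zero} _ ()
x∈p─q⇒x∉q (_ ∷ p) (_ ∷ q) {suc x} (there x∈) (there x∈q) = x∈p─q⇒x∉q p q x∈ x∈q

injective⇒≤∣∣ : ∀ {k m} (f : Fin k → Fin m) → (∀ {i j} → f i ≡ f j → i ≡ j) →
                 (S : Subset m) → (∀ t → f t ∈ S) → k ≤ ∣ S ∣
injective⇒≤∣∣ {zero} f f-inj S f∈ = z≤n
injective⇒≤∣∣ {suc k} f f-inj S f∈ = ≤-trans
  (s≤s (injective⇒≤∣∣ (λ t → f (inject₁ t)) (λ e → Fin.inject₁-injective (f-inj e)) (S - f (fromℕ k))
     (λ t → x∈p∧x≢y⇒x∈p-y (f∈ _) (λ e → Fin.fromℕ≢inject₁ (sym (f-inj e))))))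
  (x∈p⇒∣p-x∣<∣p∣ (f∈ (fromℕ k)))

covered⇒∣∣≤ : ∀ {k m} (f : Fin k → Fin m) (S : Subset m) → (∀ {x} → x ∈ S → ∃ λ t → f t ≡ x) → ∣ S ∣ ≤ k
covered⇒∣∣≤ {zero} {m} f S covered = ≤-trans (p⊆q⇒∣p∣≤∣q∣ {q = ∅} (λ x∈ → ⊥-elim (nothing (covered x∈))))
    (≤-reflexive (∣⊥∣≡0 m))
  where
  nothing : ∀ {x} → ∃ (λ (t : Fin 0) → f t ≡ x) → ⊥
  nothing (() , _)
covered⇒∣∣≤ {suc k} f S covered = ≤-trans (∣p∣≤1+∣p-x∣ S (f (fromℕ k)))
  (s≤s (covered⇒∣∣≤ (λ t → f (inject₁ t)) (S - f (fromℕ k)) covered′))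
  where
  covered′ : ∀ {x} → x ∈ S - f (fromℕ k) → ∃ λ t → f (inject₁ t) ≡ x
  covered′ x∈ with covered (p─q⊆p S _ x∈)
  ... | t , refl with lastView t
  ... | last = contradiction (x∈⁅x⁆ _) (x∈p─q⇒x∉q S _ x∈)
  ... | inner s = s , refl

p⊆q-x-y⇒2+∣p∣≤∣q∣ : ∀ {m} {p q : Subset m} {x y} → x ∈ q → y ∈ q - x → p ⊆ (q - x) - y → 2 + ∣ p ∣ ≤ ∣ q ∣
p⊆q-x-y⇒2+∣p∣≤∣q∣ x∈q y∈q-x p⊆ = ≤-trans (s≤s (≤-trans (s≤s (p⊆q⇒∣p∣≤∣q∣ p⊆)) (x∈p⇒∣p-x∣<∣p∣ y∈q-x))) (x∈p⇒∣p-x∣<∣p∣ x∈q)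

p⊆q∧∣q∣≤∣p∣⇒q⊆p : ∀ {m} {p q : Subset m} → p ⊆ q → ∣ q ∣ ≤ ∣ p ∣ → q ⊆ p
p⊆q∧∣q∣≤∣p∣⇒q⊆p {p = p} p⊆q ∣q∣≤∣p∣ {x} x∈q with x ∈? p
... | yes x∈p = x∈p
... | no x∉p = contradiction ∣q∣≤∣p∣ (<⇒≱ (p⊂q⇒∣p∣<∣q∣ (p⊆q , x , x∈q , x∉p)))

p⊆q∧p≢q⇒∣p∣<∣q∣ : ∀ {m} {p q : Subset m} → p ⊆ q → p ≢ q → ∣ p ∣ < ∣ q ∣
p⊆q∧p≢q⇒∣p∣<∣q∣ {p = p} {q} p⊆q p≢q with ∣ q ∣ ≤? ∣ p ∣
... | yes ∣q∣≤∣p∣ = contradiction (⊆-antisym p⊆q (p⊆q∧∣q∣≤∣p∣⇒q⊆p p⊆q ∣q∣≤∣p∣)) p≢q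
... | no ∣q∣≰∣p∣ = ≰⇒> ∣q∣≰∣p∣

∪-elim : ∀ {m} {p q : Subset m} {P : Fin m → Set} → (∀ {z} → z ∈ p → P z) → (∀ {z} → z ∈ q → P z) →
         ∀ {z} → z ∈ p ∪ q → P z
∪-elim {p = p} {q} onP onQ z∈ with x∈p∪q⁻ p q z∈
... | inj₁ z∈p = onP z∈p
... | inj₂ z∈q = onQ z∈q

x∉p∧x∉q⇒x∉p∪q : ∀ {m} {p q : Subset m} {x} → x ∉ p → x ∉ q → x ∉ p ∪ q
x∉p∧x∉q⇒x∉p∪q {p = p} {q} x∉p x∉q x∈ with x∈p∪q⁻ p q x∈
... | inj₁ x∈p = x∉p x∈p
... | inj₂ x∈q = x∉q x∈q

x≢y∧x≢z⇒x∉⁅y⁆∪⁅z⁆ : ∀ {m} {x y z : Fin m} → x ≢ y → x ≢ z → x ∉ ⁅ y ⁆ ∪ ⁅ z ⁆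
x≢y∧x≢z⇒x∉⁅y⁆∪⁅z⁆ x≢y x≢z = x∉p∧x∉q⇒x∉p∪q (x≢y⇒x∉⁅y⁆ x≢y) (x≢y⇒x∉⁅y⁆ x≢z)

x∈⁅y⁆∪⁅z⁆⇒x≡y⊎x≡z : ∀ {m} {x y z : Fin m} → x ∈ ⁅ y ⁆ ∪ ⁅ z ⁆ → (x ≡ y) ⊎ (x ≡ z)
x∈⁅y⁆∪⁅z⁆⇒x≡y⊎x≡z {y = y} {z} x∈ with x∈p∪q⁻ ⁅ y ⁆ ⁅ z ⁆ x∈
... | inj₁ x∈⁅y⁆ = inj₁ (x∈⁅y⁆⇒x≡y _ x∈⁅y⁆)
... | inj₂ x∈⁅z⁆ = inj₂ (x∈⁅y⁆⇒x≡y _ x∈⁅z⁆)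

x∈q∧x∉p⇒p≢q : ∀ {m} {p q : Subset m} {x} → x ∈ q → x ∉ p → p ≢ q
x∈q∧x∉p⇒p≢q x∈q x∉p refl = x∉p x∈q

-- Circuit-hyperplanes of the lift matroid

module Matroid {n m : ℕ} (ends : Fin m → Fin n × Fin n) (B : Subset m → Set) where

  Family : Subset m → Set
  Family = LiftFamily ends B

  Circuit : Subset m → Set
  Circuit = LiftCircuit ends B

  Indep : Subset m → Set
  Indep = Independent ends B

  Rank : Subset m → ℕ → Set
  Rank = IsRank ends B

  cycle-nonempty : ∀ {X} → IsCycle ends X → Nonempty X
  cycle-nonempty (_ , _ , e , _ , _ , _ , _ , X≡) = e zero , from (X≡ (e zero)) (zero , refl)

  path-nonempty : ∀ {u v} → u ≢ v → (P : Path ends u v) → Fin (Path.len P)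
  path-nonempty u≢v record { len = zero ; start = s ; end = e } = ⊥-elim (u≢v (trans (sym s) e))
  path-nonempty u≢v record { len = suc _ } = zero

  family-nonempty : ∀ {D} → Family D → Nonempty D
  family-nonempty (inj₁ (cyc , _)) = cycle-nonempty cyc
  family-nonempty (inj₂ (inj₁ ((_ , _ , P₁ , _ , _ , u≢v , _ , _ , _ , D≡) , _))) =
    let i = path-nonempty u≢v P₁ in Path.edg P₁ i , from (D≡ _) (inj₁ (i , refl))
  family-nonempty (inj₂ (inj₂ (_ , _ , (cyc , _) , _ , _ , _ , refl))) =
    let x , x∈ = cycle-nonempty cyc in x , x∈p∪q⁺ (inj₁ x∈)

  ∅-independent : Indep ∅
  ∅-independent C (famC , _) C⊆∅ = let _ , x∈ = family-nonempty famC in ∉⊥ (C⊆∅ x∈)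

  independent-⊆ : ∀ {I J} → J ⊆ I → Indep I → Indep J
  independent-⊆ J⊆I indI C circC C⊆J = indI C circC (λ x∈ → J⊆I (C⊆J x∈))

  family-contains-circuit : ∀ D → Acc _<_ ∣ D ∣ → Family D → ¬ ¬ (∃ λ C → Circuit C × C ⊆ D)
  family-contains-circuit D (acc smaller) famD found = ¬¬-excluded-middle {A = ∃ λ Y → Family Y × Y ⊆ D × Y ≢ D} λ
    { (yes (Y , famY , Y⊆D , Y≢D)) → family-contains-circuit Y (smaller (p⊆q∧p≢q⇒∣p∣<∣q∣ Y⊆D Y≢D)) famY
        (λ (C , circC , C⊆Y) → found (C , circC , λ x∈ → Y⊆D (C⊆Y x∈)))
    ; (no noProper) → found (D , (famD , λ Y famY Y⊆D → decidable-stable (Vec.≡-dec Bool._≟_ Y D)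
        (λ Y≢D → noProper (Y , famY , Y⊆D , Y≢D))) , λ x∈ → x∈) }

  family⊈independent : ∀ {D I} → Family D → D ⊆ I → ¬ Indep I
  family⊈independent {D} famD D⊆I indI = family-contains-circuit D (<-wellFounded _) famD
    λ (C , circC , C⊆D) → indI C circC (λ x∈ → D⊆I (C⊆D x∈))

  rank-exists : ∀ X → ¬ ¬ (∃ (Rank X))
  rank-exists X noRank = descend m (λ b m<b (J , _ , _ , ∣J∣≡b) → <⇒≱ m<b (≤-trans (≤-reflexive (sym ∣J∣≡b)) (∣p∣≤n J)))
    where
    IndepOfSize : ℕ → Set
    IndepOfSize b = Σ (Subset m) λ J → J ⊆ X × Indep J × ∣ J ∣ ≡ b
    descend : ∀ s → (∀ b → s < b → ¬ IndepOfSize b) → ⊥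
    descend s noneAbove = ¬¬-excluded-middle {A = IndepOfSize s} λ
      { (yes (J , J⊆X , indJ , ∣J∣≡s)) → noRank (s , J , J⊆X , indJ , ∣J∣≡s ,
          λ J′ J′⊆X indJ′ → decidable-stable (∣ J′ ∣ ≤? s) (λ ∣J′∣≰s → noneAbove _ (≰⇒> ∣J′∣≰s) (J′ , J′⊆X , indJ′ , refl)))
      ; (no noneAt) → below s noneAbove noneAt }
      where
      below : ∀ s → (∀ b → s < b → ¬ IndepOfSize b) → ¬ IndepOfSize s → ⊥
      below zero _ noneAt0 = noneAt0 (∅ , (λ x∈ → ⊥-elim (∉⊥ x∈)) , ∅-independent , ∣⊥∣≡0 m)
      below (suc s) noneAbove noneAt = descend s λ b s<b → case m≤n⇒m<n∨m≡n s<b of λ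
        { (inj₁ 1+s<b) → noneAbove b 1+s<b
        ; (inj₂ refl) → noneAt }

  independent⊂circuit⇒< : ∀ {C J} → Circuit C → J ⊆ C → Indep J → ∣ J ∣ < ∣ C ∣
  independent⊂circuit⇒< {C} {J} circC J⊆C indJ with suc ∣ J ∣ ≤? ∣ C ∣
  ... | yes ∣J∣<∣C∣ = ∣J∣<∣C∣
  ... | no ∣J∣≮∣C∣ = ⊥-elim (indJ C circC (p⊆q∧∣q∣≤∣p∣⇒q⊆p J⊆C (≤-pred (≰⇒> ∣J∣≮∣C∣))))

  circuit-delete-independent : ∀ {C x} → Circuit C → x ∈ C → Indep (C - x)
  circuit-delete-independent {C} {x} (_ , minimal) x∈C D (famD , _) D⊆C-x
    with minimal D famD (λ y∈ → p─q⊆p C ⁅ x ⁆ (D⊆C-x y∈))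
  ... | refl = x∈p─q⇒x∉q C ⁅ x ⁆ (D⊆C-x x∈C) (x∈⁅x⁆ x)

  circuit-size≤1+rank : ∀ {C r} → Circuit C → Rank C r → ∣ C ∣ ≤ suc r
  circuit-size≤1+rank {C} circC (_ , _ , _ , _ , maximal) =
    let x , x∈C = family-nonempty (proj₁ circC)
    in ≤-trans (∣p∣≤1+∣p-x∣ C x) (s≤s (maximal (C - x) (p─q⊆p C ⁅ x ⁆) (circuit-delete-independent circC x∈C)))

  -- Adding e to the flat C raises the rank to at least |C|, so a basis of C ∪ {e}
  -- misses exactly one element of C ∪ {e}, and it lies in C because C is dependent.
  flat-circuit-exchange : ∀ {C e} → Circuit C → IsFlat ends B C → e ∉ C →
                          ¬ ¬ (∃ λ y → y ∈ C × Indep ((C ∪ ⁅ e ⁆) - y))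
  flat-circuit-exchange {C} {e} circC flatC e∉C found =
    rank-exists C λ (r , rankC) → rank-exists (C ∪ ⁅ e ⁆) λ (s , rankC+e@(I , I⊆ , indI , ∣I∣≡s , _)) →
      let ∣C∣≤∣I∣ : ∣ C ∣ ≤ ∣ I ∣
          ∣C∣≤∣I∣ = ≤-trans (circuit-size≤1+rank circC rankC)
                      (≤-trans (flatC e e∉C r s rankC rankC+e) (≤-reflexive (sym ∣I∣≡s)))
      in case Fin.any? (λ y → (y ∈? C) ×-dec ¬? (y ∈? I)) of λ
        { (no C⊆I) → indI C circC (λ {y} y∈C → decidable-stable (y ∈? I) (λ y∉I → C⊆I (y , y∈C , y∉I)))
        ; (yes (y , y∈C , y∉I)) → found (y , y∈C , independent-⊆ (λ {z} z∈ → decidable-stable (z ∈? I)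
            (λ z∉I → 1+n≰n (≤-trans (p⊆q-x-y⇒2+∣p∣≤∣q∣ (x∈p∪q⁺ (inj₁ y∈C)) z∈
                                         (λ x∈I → x∈p∧x≢y⇒x∈p-y (x∈p∧x≢y⇒x∈p-y (I⊆ x∈I) (λ { refl → y∉I x∈I }))
                                                                          (λ { refl → z∉I x∈I })))
                                      (≤-trans (∣p∪⁅x⁆∣≤1+∣p∣ C e) (s≤s ∣C∣≤∣I∣))))) indI) }

  circuitHyperplane-maximum : ∀ {C I} → Circuit C → IsHyperplane ends B C → Indep I → ∣ I ∣ ≤ ∣ C ∣
  circuitHyperplane-maximum {C} {I} circC (_ , corank1) indI = decidable-stable (∣ I ∣ ≤? ∣ C ∣) λ ∣I∣≰∣C∣ →
    rank-exists ⊤ λ (R , rank⊤@(_ , _ , _ , _ , maximal⊤)) → rank-exists C λ (h , rankC@(J , J⊆C , indJ , ∣J∣≡h , _)) →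
      ∣I∣≰∣C∣ (begin
        ∣ I ∣       ≤⟨ maximal⊤ I (λ _ → ∈⊤) indI ⟩
        R           ≡⟨ sym (corank1 R h rank⊤ rankC) ⟩
        suc h       ≡⟨ cong suc (sym ∣J∣≡h) ⟩
        suc ∣ J ∣   ≤⟨ independent⊂circuit⇒< circC J⊆C indJ ⟩
        ∣ C ∣       ∎)
    where open Data.Nat.Properties.≤-Reasoning

  circuitHyperplane-proper : ∀ {C} → IsHyperplane ends B C → ¬ (∀ e → e ∈ C)
  circuitHyperplane-proper {C} (_ , corank1) everything =
    rank-exists ⊤ λ (R , rank⊤@(I , _ , indI , ∣I∣≡R , _)) → rank-exists C λ (h , rankC@(_ , _ , _ , _ , maximalC)) →
      1+n≰n (≤-trans (≤-reflexive (corank1 R h rank⊤ rankC))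
                     (≤-trans (≤-reflexive (sym ∣I∣≡R)) (maximalC I (λ {x} _ → everything x) indI)))

  Within : Subset m → Fin m → Subset m → Set
  Within C e D = ∀ {z} → z ∈ D → z ∈ C ⊎ z ≡ e

  ExchangeDependent : Subset m → Fin m → Fin m → Set
  ExchangeDependent C e y = ∃ λ D → Family D × Within C e D × y ∉ D

  circuitHyperplane-exchange : ∀ {C} → IsCircuitHyperplane ends B C →
                               ¬ (∀ e → e ∉ C → ∀ y → y ∈ C → ¬ ¬ ExchangeDependent C e y)
  circuitHyperplane-exchange {C} (circC , hyperC@(flatC , _)) dependent with Fin.any? (λ e → ¬? (e ∈? C))
  ... | no noneOutside = circuitHyperplane-proper hyperC (λ e → decidable-stable (e ∈? C) (λ e∉C → noneOutside (e , e∉C)))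
  ... | yes (e , e∉C) = flat-circuit-exchange circC flatC e∉C λ (y , y∈C , indC+e-y) →
    dependent e e∉C y y∈C λ (D , famD , D⊆C+e , y∉D) →
      family⊈independent famD (λ {z} z∈D → x∈p∧x≢y⇒x∈p-y (C+e∋ (D⊆C+e z∈D)) (λ { refl → y∉D z∈D })) indC+e-y
    where
    C+e∋ : ∀ {z} → z ∈ C ⊎ z ≡ e → z ∈ C ∪ ⁅ e ⁆
    C+e∋ (inj₁ z∈C) = x∈p∪q⁺ (inj₁ z∈C)
    C+e∋ (inj₂ refl) = x∈p∪q⁺ (inj₂ (x∈⁅x⁆ _))

module Walks {n m : ℕ} (ends : Fin m → Fin n × Fin n) where

  private
    V : Set
    V = Fin n
    E : Set
    E = Fin m

  joins-sym : ∀ {g a b} → Joins ends g a b → Joins ends g b a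
  joins-sym (inj₁ e) = inj₂ e
  joins-sym (inj₂ e) = inj₁ e

  joins⇒incidentˡ : ∀ {g a b} → Joins ends g a b → Incident ends g a
  joins⇒incidentˡ (inj₁ e) = inj₁ (cong proj₁ e)
  joins⇒incidentˡ (inj₂ e) = inj₂ (cong proj₂ e)

  joins⇒incidentʳ : ∀ {g a b} → Joins ends g a b → Incident ends g b
  joins⇒incidentʳ j = joins⇒incidentˡ (joins-sym j)

  incident⇒endpoint : ∀ {g a b x} → Joins ends g a b → Incident ends g x → (x ≡ a) ⊎ (x ≡ b)
  incident⇒endpoint (inj₁ e) (inj₁ i) = inj₁ (trans (sym i) (cong proj₁ e))
  incident⇒endpoint (inj₁ e) (inj₂ i) = inj₂ (trans (sym i) (cong proj₂ e))
  incident⇒endpoint (inj₂ e) (inj₁ i) = inj₂ (trans (sym i) (cong proj₁ e))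
  incident⇒endpoint (inj₂ e) (inj₂ i) = inj₁ (trans (sym i) (cong proj₂ e))

  joins⇒parallel : ∀ {g h a b} → Joins ends g a b → Joins ends h a b → Parallel ends g h
  joins⇒parallel (inj₁ e) jh rewrite e = jh
  joins⇒parallel (inj₂ e) jh rewrite e = joins-sym jh

  joins-endpoints : ∀ {e a b c d} → Joins ends e a b → Joins ends e c d → (a ≡ c × b ≡ d) ⊎ (a ≡ d × b ≡ c)
  joins-endpoints (inj₁ x) (inj₁ y) = inj₁ (cong proj₁ (trans (sym x) y) , cong proj₂ (trans (sym x) y))
  joins-endpoints (inj₁ x) (inj₂ y) = inj₂ (cong proj₁ (trans (sym x) y) , cong proj₂ (trans (sym x) y))
  joins-endpoints (inj₂ x) (inj₁ y) = inj₂ (cong proj₂ (trans (sym x) y) , cong proj₁ (trans (sym x) y))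
  joins-endpoints (inj₂ x) (inj₂ y) = inj₁ (cong proj₂ (trans (sym x) y) , cong proj₁ (trans (sym x) y))

  NonLoop : E → Set
  NonLoop g = proj₁ (ends g) ≢ proj₂ (ends g)

  joins⇒nonLoop : ∀ {g a b} → Joins ends g a b → a ≢ b → NonLoop g
  joins⇒nonLoop (inj₁ e) ab r = ab (trans (cong proj₁ (sym e)) (trans r (cong proj₂ e)))
  joins⇒nonLoop (inj₂ e) ab r = ab (sym (trans (cong proj₁ (sym e)) (trans r (cong proj₂ e))))

  loop⇒¬nonLoop : ∀ {g a} → Joins ends g a a → ¬ NonLoop g
  loop⇒¬nonLoop (inj₁ e) r = r (trans (cong proj₁ e) (sym (cong proj₂ e)))
  loop⇒¬nonLoop (inj₂ e) r = r (trans (cong proj₁ e) (sym (cong proj₂ e)))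

  loop⊎nonLoop : ∀ e → (∃ λ a → Joins ends e a a) ⊎ (∃₂ λ a b → Joins ends e a b × a ≢ b)
  loop⊎nonLoop e with proj₁ (ends e) Fin.≟ proj₂ (ends e)
  ... | yes eq = inj₁ (_ , inj₁ (cong (proj₁ (ends e) ,_) (sym eq)))
  ... | no ne = inj₂ (_ , _ , inj₁ refl , ne)

  record CycleWalk (X : Subset m) : Set where
    field
      p    : ℕ
      vertex   : Fin (suc p) → V
      edge    : Fin (suc p) → E
      vertex-injective : ∀ {i j} → vertex i ≡ vertex j → i ≡ j
      edge-injective : ∀ {i j} → edge i ≡ edge j → i ≡ j
      joins   : ∀ t → Joins ends (edge t) (vertex t) (vertex (next t))
      edge-onto : ∀ {f} → f ∈ X → ∃ λ t → edge t ≡ f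
      edge∈ : ∀ t → edge t ∈ X

  open CycleWalk

  cycle⇒walk : ∀ {X} → IsCycle ends X → CycleWalk X
  cycle⇒walk (k , wk , e , w0 , winj , einj' , step , iff) = record
    { p = k ; vertex = λ i → wk (inject₁ i) ; edge = e
    ; vertex-injective = λ eq → winj _ _ eq ; edge-injective = λ eq → einj' _ _ eq
    ; joins = λ t → subst (Joins ends (e t) (wk (inject₁ t))) (ws t) (step t)
    ; edge-onto = λ {f} f∈ → to (iff f) f∈
    ; edge∈ = λ t → from (iff (e t)) (t , refl) }
    where
    ws : ∀ t → wk (suc t) ≡ wk (inject₁ (next t))
    ws t with lastView t
    ... | last = sym w0
    ... | inner j = refl

  wrap : ∀ {p} → Fin (suc (suc p)) → Fin (suc p)
  wrap t with lastView t
  ... | last = zero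
  ... | inner j = j

  wrap-inject₁ : ∀ {p} (i : Fin (suc p)) → wrap (inject₁ i) ≡ i
  wrap-inject₁ i rewrite lastView-inject₁ i = refl

  wrap-suc : ∀ {p} (i : Fin (suc p)) → wrap (suc i) ≡ next i
  wrap-suc {p} i with lastView i
  ... | last = refl
  ... | inner j = refl

  wrap-fromℕ : ∀ p → wrap (fromℕ (suc p)) ≡ zero
  wrap-fromℕ p rewrite lastView-fromℕ (suc p) = refl

  walk⇒cycle : ∀ {X} → CycleWalk X → IsCycle ends X
  walk⇒cycle {X} R = p R , (λ i → vertex R (wrap i)) , edge R , cong (vertex R) (sym (wrap-fromℕ (p R)))
    , (λ i j eq → vertex-injective R (subst₂ (λ a b → vertex R a ≡ vertex R b) (wrap-inject₁ i) (wrap-inject₁ j) eq))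
    , (λ i j eq → edge-injective R eq)
    , (λ i → subst₂ (Joins ends (edge R i)) (cong (vertex R) (sym (wrap-inject₁ i))) (cong (vertex R) (sym (wrap-suc i)))
                    (joins R i))
    , λ f → mk⇔ (edge-onto R) (λ { (t , refl) → edge∈ R t })

  vertexOf⇒onWalk : ∀ {X x} (R : CycleWalk X) → VertexOf ends X x → ∃ λ t → vertex R t ≡ x
  vertexOf⇒onWalk R (f , f∈ , inc) with edge-onto R f∈
  ... | t , refl with incident⇒endpoint (joins R t) inc
  ... | inj₁ e = t , sym e
  ... | inj₂ e = next t , sym e

  walk-vertexOf : ∀ {X} (R : CycleWalk X) t → VertexOf ends X (vertex R t)
  walk-vertexOf R t = edge R t , edge∈ R t , joins⇒incidentˡ (joins R t)

  next≡id : ∀ {p} → ¬ (1 ≤ p) → (t : Fin (suc p)) → next t ≡ t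
  next≡id {zero} _ zero = refl
  next≡id {suc p} h t = ⊥-elim (h (s≤s z≤n))

  ≡0⊎≡1⊎≥2 : ∀ p → (p ≡ 0) ⊎ (p ≡ 1) ⊎ (2 ≤ p)
  ≡0⊎≡1⊎≥2 zero = inj₁ refl
  ≡0⊎≡1⊎≥2 (suc zero) = inj₂ (inj₁ refl)
  ≡0⊎≡1⊎≥2 (suc (suc p)) = inj₂ (inj₂ (s≤s (s≤s z≤n)))

  single-index : ∀ {p} → p ≡ 0 → (t : Fin (suc p)) → t ≡ zero
  single-index refl zero = refl

  next²≡id : ∀ {p} → p ≡ 1 → (t : Fin (suc p)) → next (next t) ≡ t
  next²≡id refl zero = refl
  next²≡id refl (suc zero) = refl

  ≡0⇒≱1 : ∀ {p} → p ≡ 0 → ¬ (1 ≤ p)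
  ≡0⇒≱1 refl ()

  ≡1⇒≥1 : ∀ {p} → p ≡ 1 → 1 ≤ p
  ≡1⇒≥1 refl = s≤s z≤n

  one-edge-loop : ∀ {X} (R : CycleWalk X) → p R ≡ 0 → Joins ends (edge R zero) (vertex R zero) (vertex R zero)
  one-edge-loop R e =
    subst (λ z → Joins ends (edge R zero) (vertex R zero) (vertex R z)) (next≡id (≡0⇒≱1 e) zero) (joins R zero)

  one-edge-only : ∀ {X} (R : CycleWalk X) → p R ≡ 0 → ∀ {f} → f ∈ X → f ≡ edge R zero
  one-edge-only R e h with edge-onto R h
  ... | t , refl = cong (edge R) (single-index e t)

  two-edge-parallel : ∀ {X} (R : CycleWalk X) → p R ≡ 1 →
                      Joins ends (edge R (next zero)) (vertex R zero) (vertex R (next zero))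
  two-edge-parallel R e = joins-sym (subst (λ z → Joins ends (edge R (next zero)) (vertex R (next zero)) (vertex R z))
                                           (next²≡id e zero) (joins R (next zero)))

  two-edge-distinct : ∀ {X} (R : CycleWalk X) → p R ≡ 1 → edge R zero ≢ edge R (next zero)
  two-edge-distinct R e r = next≢id (≡1⇒≥1 e) zero (sym (edge-injective R r))

  two-vertex-distinct : ∀ {X} (R : CycleWalk X) → p R ≡ 1 → vertex R zero ≢ vertex R (next zero)
  two-vertex-distinct R e r = next≢id (≡1⇒≥1 e) zero (sym (vertex-injective R r))

  walk-size : ∀ {X} (R : CycleWalk X) → ∣ X ∣ ≤ suc (p R)
  walk-size R = covered⇒∣∣≤ (edge R) _ (edge-onto R)

  loop∉walk : ∀ {X ℓ a} (R : CycleWalk X) → 1 ≤ p R → Joins ends ℓ a a → ℓ ∉ X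
  loop∉walk R le j h with edge-onto R h
  ... | t , refl = loop⇒¬nonLoop j (joins⇒nonLoop (joins R t) (λ e → next≢id le t (sym (vertex-injective R e))))

  joins-walk-index : ∀ {X} (R : CycleWalk X) → 2 ≤ p R → ∀ {e s t} → Joins ends e (vertex R s) (vertex R (next s)) →
                     Joins ends e (vertex R t) (vertex R (next t)) → s ≡ t
  joins-walk-index R le js jt with joins-endpoints js jt
  ... | inj₁ (a , _) = vertex-injective R a
  ... | inj₂ (a , b) = ⊥-elim (next²≢id le _ (trans (cong next (sym (vertex-injective R a))) (vertex-injective R b)))

  loopWalk : ∀ {ℓ a} → Joins ends ℓ a a → CycleWalk ⁅ ℓ ⁆
  loopWalk {ℓ} {a} j = record
    { p = 0 ; vertex = λ _ → a ; edge = λ _ → ℓ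
    ; vertex-injective = λ { {zero} {zero} _ → refl } ; edge-injective = λ { {zero} {zero} _ → refl } ; joins = λ _ → j
    ; edge-onto = λ f∈ → zero , sym (x∈⁅y⁆⇒x≡y _ f∈) ; edge∈ = λ _ → x∈⁅x⁆ ℓ }

  two : ∀ {A : Set} → A → A → Fin 2 → A
  two a b zero = a
  two a b (suc zero) = b

  digonWalk : ∀ {g g' a b} → g ≢ g' → a ≢ b → Joins ends g a b → Joins ends g' a b → CycleWalk (⁅ g ⁆ ∪ ⁅ g' ⁆)
  digonWalk {g} {g'} {a} {b} gg ab jg jg' = record
    { p = 1 ; vertex = two a b ; edge = two g g'
    ; vertex-injective = xi ; edge-injective = ei ; joins = λ { zero → jg ; (suc zero) → joins-sym jg' }
    ; edge-onto = mp
    ; edge∈ = λ { zero → x∈p∪q⁺ (inj₁ (x∈⁅x⁆ g)) ; (suc zero) → x∈p∪q⁺ (inj₂ (x∈⁅x⁆ g')) } }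
    where
    xi : ∀ {i j} → two a b i ≡ two a b j → i ≡ j
    xi {zero} {zero} _ = refl
    xi {zero} {suc zero} e = ⊥-elim (ab e)
    xi {suc zero} {zero} e = ⊥-elim (ab (sym e))
    xi {suc zero} {suc zero} _ = refl
    ei : ∀ {i j} → two g g' i ≡ two g g' j → i ≡ j
    ei {zero} {zero} _ = refl
    ei {zero} {suc zero} e = ⊥-elim (gg e)
    ei {suc zero} {zero} e = ⊥-elim (gg (sym e))
    ei {suc zero} {suc zero} _ = refl
    mp : ∀ {f} → f ∈ ⁅ g ⁆ ∪ ⁅ g' ⁆ → ∃ λ t → two g g' t ≡ f
    mp f∈ with x∈p∪q⁻ ⁅ g ⁆ ⁅ g' ⁆ f∈
    ... | inj₁ h = zero , sym (x∈⁅y⁆⇒x≡y _ h)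
    ... | inj₂ h = suc zero , sym (x∈⁅y⁆⇒x≡y _ h)

  rotateWalk : ∀ {X} (R : CycleWalk X) (j : Fin (suc (p R))) → CycleWalk X
  rotateWalk R j = record
    { p = p R ; vertex = λ t → vertex R (rotate j t) ; edge = λ t → edge R (rotate j t)
    ; vertex-injective = λ e → rotate-injective j (vertex-injective R e)
    ; edge-injective = λ e → rotate-injective j (edge-injective R e)
    ; joins = λ t → subst (λ z → Joins ends (edge R (rotate j t)) (vertex R (rotate j t)) (vertex R z))
                          (sym (rotate-next j t)) (joins R (rotate j t))
    ; edge-onto = λ f∈ → let t , e = edge-onto R f∈
                             s , e′ = injective⇒surjective (rotate j) (rotate-injective j) t
                         in s , trans (cong (edge R) e′) e
    ; edge∈ = λ t → edge∈ R (rotate j t) }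

  rotateWalk-vertex-fromℕ : ∀ {X} (R : CycleWalk X) j → vertex (rotateWalk R j) (fromℕ (p R)) ≡ vertex R j
  rotateWalk-vertex-fromℕ R j = cong (vertex R) (rotate-fromℕ j)

  rotateWalk-vertex-zero : ∀ {X} (R : CycleWalk X) j → vertex (rotateWalk R j) zero ≡ vertex R (next j)
  rotateWalk-vertex-zero R j = cong (vertex R) (rotate-zero j)

  rotateWalk-edge-zero : ∀ {X} (R : CycleWalk X) j → edge (rotateWalk R j) zero ≡ edge R (next j)
  rotateWalk-edge-zero R j = cong (edge R) (rotate-zero j)

  replaceAt : ∀ {p} → (Fin (suc p) → E) → Fin (suc p) → E → Fin (suc p) → E
  replaceAt ε' t g s with s Fin.≟ t
  ... | yes _ = g
  ... | no _ = ε' s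

  replaceAt-here : ∀ {p} (ε' : Fin (suc p) → E) t g → replaceAt ε' t g t ≡ g
  replaceAt-here ε' t g with t Fin.≟ t
  ... | yes _ = refl
  ... | no ne = ⊥-elim (ne refl)

  replaceAt-cases : ∀ {p} (ε' : Fin (suc p) → E) t g s →
                    (s ≡ t × replaceAt ε' t g s ≡ g) ⊎ (s ≢ t × replaceAt ε' t g s ≡ ε' s)
  replaceAt-cases ε' t g s with s Fin.≟ t
  ... | yes e = inj₁ (e , refl)
  ... | no ne = inj₂ (ne , refl)

  replaceWalkEdge : ∀ {X} (R : CycleWalk X) t g → (∀ s → edge R s ≢ g) → Joins ends g (vertex R t) (vertex R (next t)) →
                    CycleWalk (image (replaceAt (edge R) t g))
  replaceWalkEdge R t g ng jg = record
    { p = p R ; vertex = vertex R ; edge = replaceAt (edge R) t g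
    ; vertex-injective = vertex-injective R ; edge-injective = ei ; joins = jj
    ; edge-onto = ∈-image⁻ (replaceAt (edge R) t g) ; edge∈ = ∈-image⁺ (replaceAt (edge R) t g) }
    where
    ei : ∀ {i j} → replaceAt (edge R) t g i ≡ replaceAt (edge R) t g j → i ≡ j
    ei {i} {j} e with replaceAt-cases (edge R) t g i | replaceAt-cases (edge R) t g j
    ... | inj₁ (a , _) | inj₁ (b , _) = trans a (sym b)
    ... | inj₁ (a , x) | inj₂ (b , y) = ⊥-elim (ng j (trans (sym y) (trans (sym e) x)))
    ... | inj₂ (a , x) | inj₁ (b , y) = ⊥-elim (ng i (trans (sym x) (trans e y)))
    ... | inj₂ (a , x) | inj₂ (b , y) = edge-injective R (trans (sym x) (trans e y))
    jj : ∀ s → Joins ends (replaceAt (edge R) t g s) (vertex R s) (vertex R (next s))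
    jj s with replaceAt-cases (edge R) t g s
    ... | inj₁ (refl , x) = subst (λ z → Joins ends z (vertex R s) (vertex R (next s))) (sym x) jg
    ... | inj₂ (_ , x) = subst (λ z → Joins ends z (vertex R s) (vertex R (next s))) (sym x) (joins R s)

  ∈-replaceAt⁻ : ∀ {p} (ε' : Fin (suc p) → E) t g {z} → z ∈ image (replaceAt ε' t g) →
                 (z ≡ g) ⊎ (∃ λ s → s ≢ t × ε' s ≡ z)
  ∈-replaceAt⁻ ε' t g h with ∈-image⁻ (replaceAt ε' t g) h
  ... | s , refl with replaceAt-cases ε' t g s
  ... | inj₁ (_ , e) = inj₁ e
  ... | inj₂ (ne , e) = inj₂ (s , ne , sym e)

  Rerouted : ∀ {X} (R : CycleWalk X) → Fin (suc (p R)) → E → Subset m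
  Rerouted R t g = image (replaceAt (edge R) t g)

  rerouted-all : ∀ {X} (R : CycleWalk X) t g {P : E → Set} → (∀ s → P (edge R s)) → P g →
                 ∀ {z} → z ∈ Rerouted R t g → P z
  rerouted-all R t g onEdges onG z∈ with ∈-replaceAt⁻ (edge R) t g z∈
  ... | inj₁ refl = onG
  ... | inj₂ (s , _ , refl) = onEdges s

  removed∉rerouted : ∀ {X} (R : CycleWalk X) t g → edge R t ≢ g → edge R t ∉ Rerouted R t g
  removed∉rerouted R t g t≢g z∈ with ∈-replaceAt⁻ (edge R) t g z∈
  ... | inj₁ e = t≢g e
  ... | inj₂ (s , s≢t , e) = s≢t (edge-injective R e)

  ∉rerouted : ∀ {X} (R : CycleWalk X) t g {z} → z ≢ g → z ∉ X → z ∉ Rerouted R t g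
  ∉rerouted {X} R t g z≢g z∉X z∈ with ∈-replaceAt⁻ (edge R) t g z∈
  ... | inj₁ e = z≢g e
  ... | inj₂ (s , _ , e) = z∉X (subst (_∈ X) e (edge∈ R s))

  walk-step-distinct : ∀ {X} (R : CycleWalk X) → 1 ≤ p R → ∀ t → vertex R t ≢ vertex R (next t)
  walk-step-distinct R nontrivial t e = next≢id nontrivial t (sym (vertex-injective R e))

  walk-digon : ∀ {X g} (R : CycleWalk X) → 1 ≤ p R → ∀ t → edge R t ≢ g →
               Joins ends g (vertex R t) (vertex R (next t)) → CycleWalk (⁅ edge R t ⁆ ∪ ⁅ g ⁆)
  walk-digon R nontrivial t t≢g chord = digonWalk t≢g (walk-step-distinct R nontrivial t) (joins R t) chord

  closingEdges : ∀ {u v} (P : Path ends u v) → E → Fin (suc (Path.len P)) → E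
  closingEdges P h t with lastView t
  ... | last = h
  ... | inner i = Path.edg P i

  closePath : ∀ {u v h} (P : Path ends u v) → Joins ends h v u → (∀ i → Path.edg P i ≢ h) →
             CycleWalk (image (closingEdges P h))
  closePath {u} {v} {h} P jh nh = record { p = len P ; vertex = vtx P ; edge = closingEdges P h ; vertex-injective = vinj P _ _
      ; edge-injective = ci ; joins = cj ; edge-onto = ∈-image⁻ (closingEdges P h) ; edge∈ = ∈-image⁺ (closingEdges P h) }
    where
    open Path
    ci : ∀ {i j} → closingEdges P h i ≡ closingEdges P h j → i ≡ j
    ci {i} {j} e with lastView i | lastView j
    ... | last | last = refl
    ... | last | inner b = ⊥-elim (nh b (sym e))
    ... | inner a | last = ⊥-elim (nh a e)
    ... | inner a | inner b = cong inject₁ (Path.einj P _ _ e)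
    cj : ∀ t → Joins ends (closingEdges P h t) (vtx P t) (vtx P (next t))
    cj t with lastView t
    ... | last = subst₂ (Joins ends h) (sym (end P)) (sym (start P)) jh
    ... | inner i = step P i

  closingEdges-cases : ∀ {u v} (P : Path ends u v) h t →
                       (closingEdges P h t ≡ h) ⊎ (∃ λ i → closingEdges P h t ≡ Path.edg P i)
  closingEdges-cases P h t with lastView t
  ... | last = inj₁ refl
  ... | inner i = inj₂ (i , refl)

  closingEdges-fromℕ : ∀ {u v} (P : Path ends u v) h → closingEdges P h (fromℕ (Path.len P)) ≡ h
  closingEdges-fromℕ P h rewrite lastView-fromℕ (Path.len P) = refl

  closingEdges-inject₁ : ∀ {u v} (P : Path ends u v) h i → closingEdges P h (inject₁ i) ≡ Path.edg P i
  closingEdges-inject₁ P h i rewrite lastView-inject₁ i = refl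

  zero≢fromℕ : ∀ {p} → 1 ≤ p → _≢_ {A = Fin (suc p)} zero (fromℕ p)
  zero≢fromℕ (s≤s z≤n) ()

  edgePath : ∀ {h u v} → Joins ends h u v → u ≢ v → Path ends u v
  edgePath {h} {u} {v} j uv = record { len = 1 ; vtx = two u v ; edg = λ _ → h ; start = refl ; end = refl
    ; vinj = vi ; einj = λ { zero zero _ → refl } ; step = λ { zero → j } }
    where
    vi : ∀ i j → two u v i ≡ two u v j → i ≡ j
    vi zero zero _ = refl
    vi zero (suc zero) e = ⊥-elim (uv e)
    vi (suc zero) zero e = ⊥-elim (uv (sym e))
    vi (suc zero) (suc zero) _ = refl

  edgePath-vertices : ∀ {h u v} (j : Joins ends h u v) (uv : u ≢ v) x → OnPathV ends (edgePath j uv) x →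
                      (x ≡ u) ⊎ (x ≡ v)
  edgePath-vertices j uv x (zero , e) = inj₁ (sym e)
  edgePath-vertices j uv x (suc zero , e) = inj₂ (sym e)

  lastEdgeChord⇒theta : ∀ {X g} (R : CycleWalk X) → 1 ≤ p R → g ∉ X →
                        Joins ends g (vertex R (fromℕ (p R))) (vertex R zero) → IsTheta ends (X ∪ ⁅ g ⁆)
  lastEdgeChord⇒theta {X} {g} R le g∉ jg =
    u , v , P₁ , P₂ , P₃ , uv
    , ((λ f (i₁ , e₁) (i₂ , e₂) → g∉ (subst (_∈ X) (trans e₁ (sym e₂)) (edge∈ R (fromℕ (p R))))) , λ x a _ →
        edgePath-vertices j1 uv x a)
    , ((λ f (i₁ , e₁) (i₂ , e₂) → Fin.fromℕ≢inject₁ (edge-injective R (trans e₁ (sym e₂)))) , λ x a _ →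
        edgePath-vertices j1 uv x a)
    , ((λ f (i₁ , e₁) (i₂ , e₂) → g∉ (subst (_∈ X) (trans e₂ (sym e₁)) (edge∈ R (inject₁ i₂)))) , λ x a _ →
        edgePath-vertices (joins-sym jg) uv x a)
    , λ f → mk⇔ (tof f) (fromf f)
    where
    u = vertex R zero
    v = vertex R (fromℕ (p R))
    uv : u ≢ v
    uv e = zero≢fromℕ le (vertex-injective R e)
    j1 : Joins ends (edge R (fromℕ (p R))) u v
    j1 = joins-sym (subst (Joins ends (edge R (fromℕ (p R))) v) (cong (vertex R) (next-fromℕ (p R))) (joins R (fromℕ (p R))))
    P₁ = edgePath j1 uv
    P₂ = edgePath (joins-sym jg) uv
    P₃ : Path ends u v
    P₃ = record { len = p R ; vtx = vertex R ; edg = λ i → edge R (inject₁ i) ; start = refl ; end = refl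
      ; vinj = λ i j → vertex-injective R ; einj = λ i j e → Fin.inject₁-injective (edge-injective R e)
      ; step = λ i → subst (Joins ends (edge R (inject₁ i)) (vertex R (inject₁ i)))
          (cong (vertex R) (next-inject₁ i)) (joins R (inject₁ i)) }
    tof : ∀ f → f ∈ X ∪ ⁅ g ⁆ → OnPathE ends P₁ f ⊎ OnPathE ends P₂ f ⊎ OnPathE ends P₃ f
    tof f f∈ with x∈p∪q⁻ X ⁅ g ⁆ f∈
    ... | inj₂ h = inj₂ (inj₁ (zero , sym (x∈⁅y⁆⇒x≡y _ h)))
    ... | inj₁ h with edge-onto R h
    ... | t , e with lastView t
    ... | last = inj₁ (zero , e)
    ... | inner i = inj₂ (inj₂ (i , e))
    fromf : ∀ f → OnPathE ends P₁ f ⊎ OnPathE ends P₂ f ⊎ OnPathE ends P₃ f → f ∈ X ∪ ⁅ g ⁆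
    fromf f (inj₁ (zero , refl)) = x∈p∪q⁺ (inj₁ (edge∈ R _))
    fromf f (inj₂ (inj₁ (zero , refl))) = x∈p∪q⁺ (inj₂ (x∈⁅x⁆ g))
    fromf f (inj₂ (inj₂ (i , refl))) = x∈p∪q⁺ (inj₁ (edge∈ R _))

  parallelChord⇒theta : ∀ {X g} (R : CycleWalk X) → 1 ≤ p R → g ∉ X → ∀ j →
                        Joins ends g (vertex R j) (vertex R (next j)) → IsTheta ends (X ∪ ⁅ g ⁆)
  parallelChord⇒theta R le g∉ j jg = lastEdgeChord⇒theta (rotateWalk R j) le g∉
      (subst₂ (Joins ends _) (sym (rotateWalk-vertex-fromℕ R j)) (sym (rotateWalk-vertex-zero R j)) jg)

  loop-vertexOf : ∀ {ℓ a x} → Joins ends ℓ a a → VertexOf ends ⁅ ℓ ⁆ x → x ≡ a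
  loop-vertexOf j (f , f∈ , inc) with x∈⁅y⁆⇒x≡y _ f∈
  ... | refl with incident⇒endpoint j inc
  ... | inj₁ e = e
  ... | inj₂ e = e

  digon-vertexOf : ∀ {g g' a b x} (gg : g ≢ g') (ab : a ≢ b) (jg : Joins ends g a b) (jg' : Joins ends g' a b) →
            VertexOf ends (⁅ g ⁆ ∪ ⁅ g' ⁆) x → (x ≡ a) ⊎ (x ≡ b)
  digon-vertexOf gg ab jg jg' v with vertexOf⇒onWalk (digonWalk gg ab jg jg') v
  ... | zero , e = inj₁ (sym e)
  ... | suc zero , e = inj₂ (sym e)

  joins-between : ∀ {g a b x y} → Joins ends g a b → (x ≡ a) ⊎ (x ≡ b) → (y ≡ a) ⊎ (y ≡ b) → x ≢ y → Joins ends g x y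
  joins-between j (inj₁ refl) (inj₁ refl) ne = ⊥-elim (ne refl)
  joins-between j (inj₁ refl) (inj₂ refl) ne = j
  joins-between j (inj₂ refl) (inj₁ refl) ne = joins-sym j
  joins-between j (inj₂ refl) (inj₂ refl) ne = ⊥-elim (ne refl)

  last⊎inject₁ : ∀ {k} (t : Fin (suc k)) → (t ≡ fromℕ k) ⊎ ∃ λ s → t ≡ inject₁ s
  last⊎inject₁ t with lastView t
  ... | last = inj₁ refl
  ... | inner s = inj₂ (s , refl)

  path-nonLoop : ∀ {u v} (P : Path ends u v) i → NonLoop (Path.edg P i)
  path-nonLoop P i = joins⇒nonLoop (Path.step P i) (λ e → inject₁≢suc i (Path.vinj P _ _ e))

  path-firstEdge : ∀ {u v} → u ≢ v → (Q : Path ends u v) → ∃ λ g → OnPathE ends Q g × NonLoop g × Incident ends g u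
  path-firstEdge uv Q@record { len = zero ; start = s ; end = e } = ⊥-elim (uv (trans (sym s) e))
  path-firstEdge uv Q@record { len = suc l ; start = s } =
    Path.edg Q zero , (zero , refl) , path-nonLoop Q zero , subst (Incident ends (Path.edg Q zero)) s
        (joins⇒incidentˡ (Path.step Q zero))

  path-lastEdge : ∀ {u v} → u ≢ v → (Q : Path ends u v) → ∃ λ g → OnPathE ends Q g × NonLoop g × Incident ends g v
  path-lastEdge uv Q@record { len = zero ; start = s ; end = e } = ⊥-elim (uv (trans (sym s) e))
  path-lastEdge uv Q@record { len = suc l ; end = e } =
    Path.edg Q (fromℕ l) , (fromℕ l , refl) , path-nonLoop Q (fromℕ l) , subst (Incident ends (Path.edg Q (fromℕ l)))
        e (joins⇒incidentʳ (Path.step Q (fromℕ l)))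

  path-noPendant : ∀ {u v} → u ≢ v → (P Q : Path ends u v) → (∀ f → OnPathE ends P f → ¬ OnPathE ends Q f) →
          ∀ i x → Incident ends (Path.edg P i) x →
          ∃ λ g' → (OnPathE ends P g' ⊎ OnPathE ends Q g') × g' ≢ Path.edg P i × NonLoop g' × Incident ends g' x
  path-noPendant {u} {v} uv P Q dj i x inc with incident⇒endpoint (Path.step P i) inc
  ... | inj₂ refl with last⊎inject₁ (suc i)
  ...   | inj₂ (i' , e) = Path.edg P i' , inj₁ (i' , refl)
          , (λ r → inject₁≢suc i (trans (cong inject₁ (sym (Path.einj P _ _ r))) (sym e)))
          , path-nonLoop P i' , subst (Incident ends (Path.edg P i')) (cong (Path.vtx P) (sym e))
              (joins⇒incidentˡ (Path.step P i'))
  ...   | inj₁ e with path-lastEdge uv Q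
  ...     | g' , oq , nl , ic = g' , inj₂ oq , (λ r → dj _ (i , refl) (subst (OnPathE ends Q) r oq)) , nl
          , subst (Incident ends g') (trans (sym (Path.end P)) (cong (Path.vtx P) (sym e))) ic
  path-noPendant {u} {v} uv P Q dj zero x inc | inj₁ refl with path-firstEdge uv Q
  ... | g' , oq , nl , ic = g' , inj₂ oq , (λ r → dj _ (zero , refl) (subst (OnPathE ends Q) r oq)) , nl
          , subst (Incident ends g') (sym (Path.start P)) ic
  path-noPendant {u} {v} uv P Q dj (suc i'') x inc | inj₁ refl =
    Path.edg P (inject₁ i'') , inj₁ (inject₁ i'' , refl)
    , (λ r → inject₁≢suc i'' (Path.einj P _ _ r)) , path-nonLoop P (inject₁ i'') , joins⇒incidentʳ (Path.step P (inject₁ i''))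

  NoPendantEdge : Subset m → Set
  NoPendantEdge D = ∀ g → g ∈ D → NonLoop g → ∀ x → Incident ends g x →
         ∃ λ g' → g' ∈ D × g' ≢ g × NonLoop g' × Incident ends g' x

  walk-noPendant : ∀ {X} (R : CycleWalk X) → NoPendantEdge X
  walk-noPendant R g g∈ nl x inc with edge-onto R g∈
  ... | t , refl with 1 ≤? p R
  ... | no h = ⊥-elim (nl' (subst (λ z → Joins ends (edge R t) (vertex R t) (vertex R z)) (next≡id h t) (joins R t)))
    where
    nl' : Joins ends (edge R t) (vertex R t) (vertex R t) → ⊥
    nl' j = loop⇒¬nonLoop j nl
  ... | yes le with incident⇒endpoint (joins R t) inc
  ... | inj₂ refl = edge R (next t) , edge∈ R (next t) , (λ e → next≢id le t (edge-injective R e))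
      , joins⇒nonLoop (joins R (next t)) (λ e → next≢id le (next t) (sym (vertex-injective R e))) , joins⇒incidentˡ
          (joins R (next t))
  ... | inj₁ refl = edge R (prev t) , edge∈ R (prev t) ,
      (λ e → next≢id le (prev t) (trans (next-prev t) (sym (edge-injective R e))))
      , joins⇒nonLoop (joins R (prev t)) (λ e → next≢id le (prev t) (sym (vertex-injective R e)))
      , subst (Incident ends (edge R (prev t))) (cong (vertex R) (next-prev t)) (joins⇒incidentʳ (joins R (prev t)))

  pendant-elsewhere : ∀ {P Q : E → Set} {D g x} → (∀ {f} → P f → f ∈ D) → (∀ {f} → Q f → f ∈ D) →
                      (∃ λ g′ → (P g′ ⊎ Q g′) × g′ ≢ g × NonLoop g′ × Incident ends g′ x) →
                      ∃ λ g′ → g′ ∈ D × g′ ≢ g × NonLoop g′ × Incident ends g′ x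
  pendant-elsewhere onP onQ (g′ , inj₁ p , rest) = g′ , onP p , rest
  pendant-elsewhere onP onQ (g′ , inj₂ q , rest) = g′ , onQ q , rest

  theta-noPendant : ∀ {D} → IsTheta ends D → NoPendantEdge D
  theta-noPendant (u , v , P₁ , P₂ , P₃ , u≢v , (P₁∩P₂ , _) , (P₁∩P₃ , _) , _ , D≡) g g∈D _ x inc with to (D≡ g) g∈D
  ... | inj₁ (i , refl) = pendant-elsewhere (λ o → from (D≡ _) (inj₁ o)) (λ o → from (D≡ _) (inj₂ (inj₁ o)))
                             (path-noPendant u≢v P₁ P₂ P₁∩P₂ i x inc)
  ... | inj₂ (inj₁ (i , refl)) = pendant-elsewhere (λ o → from (D≡ _) (inj₂ (inj₁ o))) (λ o → from (D≡ _) (inj₁ o))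
                                   (path-noPendant u≢v P₂ P₁ (λ f on₂ on₁ → P₁∩P₂ f on₁ on₂) i x inc)
  ... | inj₂ (inj₂ (i , refl)) = pendant-elsewhere (λ o → from (D≡ _) (inj₂ (inj₂ o))) (λ o → from (D≡ _) (inj₁ o))
                                   (path-noPendant u≢v P₃ P₁ (λ f on₃ on₁ → P₁∩P₃ f on₁ on₃) i x inc)

module Families {n m : ℕ} (ends : Fin m → Fin n × Fin n) (B : Subset m → Set) where

  open Matroid ends B
  open Walks ends
  open CycleWalk

  balanced-family : ∀ {X} → CycleWalk X → B X → Family X
  balanced-family R b = inj₁ (walk⇒cycle R , b)

  MeetAtMostOnce : Subset m → Subset m → Set
  MeetAtMostOnce X₁ X₂ = ∀ x y → VertexOf ends X₁ x → VertexOf ends X₂ x → VertexOf ends X₁ y → VertexOf ends X₂ y → x ≡ y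

  handcuff-family : ∀ {X₁ X₂} → CycleWalk X₁ → CycleWalk X₂ → ¬ B X₁ → ¬ B X₂ → X₁ ≢ X₂ → MeetAtMostOnce X₁ X₂ →
                    Family (X₁ ∪ X₂)
  handcuff-family {X₁} {X₂} R₁ R₂ n₁ n₂ ne sh = inj₂
      (inj₂ (X₁ , X₂ , (walk⇒cycle R₁ , n₁) , (walk⇒cycle R₂ , n₂) , ne , sh , refl))

  loop-meets : ∀ {X ℓ a} → Joins ends ℓ a a → MeetAtMostOnce X ⁅ ℓ ⁆
  loop-meets j x y _ vx _ vy = trans (loop-vertexOf j vx) (sym (loop-vertexOf j vy))

  family-noPendant : ∀ {D} → Family D → NoPendantEdge D
  family-noPendant (inj₁ (cyc , _)) = walk-noPendant (cycle⇒walk cyc)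
  family-noPendant (inj₂ (inj₁ (theta , _))) = theta-noPendant theta
  family-noPendant (inj₂ (inj₂ (X₁ , X₂ , (cyc₁ , _) , (cyc₂ , _) , _ , _ , refl))) g g∈ nonLoop x inc
    with x∈p∪q⁻ X₁ X₂ g∈
  ... | inj₁ g∈X₁ = let g′ , g′∈X₁ , rest = walk-noPendant (cycle⇒walk cyc₁) g g∈X₁ nonLoop x inc
                    in g′ , x∈p∪q⁺ (inj₁ g′∈X₁) , rest
  ... | inj₂ g∈X₂ = let g′ , g′∈X₂ , rest = walk-noPendant (cycle⇒walk cyc₂) g g∈X₂ nonLoop x inc
                    in g′ , x∈p∪q⁺ (inj₂ g′∈X₂) , rest

  within-⊆ : ∀ {C e D} → D ⊆ C → Within C e D
  within-⊆ D⊆C z∈ = inj₁ (D⊆C z∈)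

  within-new : ∀ {C e} → Within C e ⁅ e ⁆
  within-new z∈ = inj₂ (x∈⁅y⁆⇒x≡y _ z∈)

  within-old : ∀ {C e a} → a ∈ C → Within C e ⁅ a ⁆
  within-old {C} a∈C z∈ = inj₁ (subst (_∈ C) (sym (x∈⁅y⁆⇒x≡y _ z∈)) a∈C)

  exchange : ∀ {C e y} D → Family D → Within C e D → y ∉ D → ¬ ¬ ExchangeDependent C e y
  exchange D famD D⊆ y∉D noExchange = noExchange (D , famD , D⊆ , y∉D)

module ClassGraph {K m : ℕ} (ends : Fin m → Fin (5 + K) × Fin (5 + K)) (B : Subset m → Set)
          (usc : UnderlyingSimpleIsCycle ends) (par2 : ParallelClassesAtMostTwo ends)
          (hamB : ∀ X → B X → IsHamiltonianCycle ends X) where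

  open Matroid ends B
  open Walks ends
  open CycleWalk
  open Families ends B

  N : ℕ
  N = suc (suc (suc (suc K)))

  V : Set
  V = Fin (suc N)

  E : Set
  E = Fin m

  w : Fin (suc (suc N)) → V
  w = proj₁ usc

  ordering : V → V
  ordering i = w (inject₁ i)

  ordering-injective : ∀ {i j} → ordering i ≡ ordering j → i ≡ j
  ordering-injective = proj₁ (proj₂ (proj₂ usc)) _ _

  ordering-next : ∀ i → w (suc i) ≡ ordering (next i)
  ordering-next i with lastView i
  ... | last = sym (proj₁ (proj₂ usc))
  ... | inner j = refl

  position : V → V
  position y = proj₁ (injective⇒surjective ordering ordering-injective y)

  ordering-position : ∀ y → ordering (position y) ≡ y
  ordering-position y = proj₂ (injective⇒surjective ordering ordering-injective y)

  position-ordering : ∀ i → position (ordering i) ≡ i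
  position-ordering i = ordering-injective (ordering-position (ordering i))

  succ : V → V
  succ x = ordering (next (position x))

  succ-injective : ∀ {x y} → succ x ≡ succ y → x ≡ y
  succ-injective {x} {y} e = trans (sym (ordering-position x))
      (trans (cong ordering (next-injective (ordering-injective e))) (ordering-position y))

  succ-ordering : ∀ i → succ (ordering i) ≡ ordering (next i)
  succ-ordering i = cong (λ z → ordering (next z)) (position-ordering i)

  adjacent⇔ : ∀ u v → u ≢ v →
              Adjacent ends u v ⇔ (∃[ i ] (((w (inject₁ i) ≡ u) × (w (suc i) ≡ v)) ⊎ ((w (inject₁ i) ≡ v) × (w (suc i) ≡ u))))
  adjacent⇔ = proj₂ (proj₂ (proj₂ usc))

  adjacent⇒succ : ∀ {u v} → u ≢ v → Adjacent ends u v → (v ≡ succ u) ⊎ (u ≡ succ v)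
  adjacent⇒succ {u} {v} ne a with to (adjacent⇔ u v ne) a
  ... | i , inj₁ (e1 , e2) = inj₁ (trans (sym e2) (trans (ordering-next i) (trans (sym (succ-ordering i)) (cong succ e1))))
  ... | i , inj₂ (e1 , e2) = inj₂ (trans (sym e2) (trans (ordering-next i) (trans (sym (succ-ordering i)) (cong succ e1))))

  succ≢id : ∀ x → succ x ≢ x
  succ≢id x e = next≢id (s≤s z≤n) (position x) (ordering-injective (trans e (sym (ordering-position x))))

  succ²≢id : ∀ x → succ (succ x) ≢ x
  succ²≢id x e = next²≢id (s≤s (s≤s z≤n)) (position x)
      (ordering-injective (trans
      (trans (cong (λ z → ordering (next z)) (sym (position-ordering (next (position x))))) e) (sym (ordering-position x))))

  ¬threeParallel : ∀ {g h k a b} → Joins ends g a b → Joins ends h a b → Joins ends k a b →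
          g ≢ h → g ≢ k → h ≢ k → ⊥
  ¬threeParallel jg jh jk gh gk hk with par2 _ _ _ (joins⇒parallel jg jh) (joins⇒parallel jg jk)
  ... | inj₁ e = gh e
  ... | inj₂ (inj₁ e) = gk e
  ... | inj₂ (inj₂ e) = hk e

  joins⇒succ : ∀ {g a b} → Joins ends g a b → a ≢ b → (b ≡ succ a) ⊎ (a ≡ succ b)
  joins⇒succ {g} j ne = adjacent⇒succ ne (g , j)

  edgeAt : ∀ i → ∃ λ g → Joins ends g (ordering i) (ordering (next i))
  edgeAt i with from (adjacent⇔ (ordering i) (ordering (next i))
      (λ e → next≢id (s≤s z≤n) i (sym (ordering-injective e)))) (i , inj₁ (refl , ordering-next i))
  ... | g , j = g , j

  balanced⇒spanning : ∀ {X} (R : CycleWalk X) → B X → suc N ≤ suc (p R)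
  balanced⇒spanning R bX = surjective⇒≥ (vertex R) (λ y → vertexOf⇒onWalk R (proj₂ (hamB _ bX) y))

  short⇒unbalanced : ∀ {X} (R : CycleWalk X) → p R < N → ¬ B X
  short⇒unbalanced R lt bX = <⇒≱ (s≤s lt) (balanced⇒spanning R bX)

  loop-unbalanced : ∀ {ℓ a} (j : Joins ends ℓ a a) → ¬ B ⁅ ℓ ⁆
  loop-unbalanced j = short⇒unbalanced (loopWalk j) (s≤s z≤n)

  Forward Backward : ∀ {X} → CycleWalk X → Set
  Forward R = ∀ t → vertex R (next t) ≡ succ (vertex R t)

  Backward R = ∀ t → vertex R t ≡ succ (vertex R (next t))

  walk-step : ∀ {X} (R : CycleWalk X) → 1 ≤ p R → ∀ t →
              (vertex R (next t) ≡ succ (vertex R t)) ⊎ (vertex R t ≡ succ (vertex R (next t)))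
  walk-step R le t = joins⇒succ (joins R t) (λ e → next≢id le t (sym (vertex-injective R e)))

  walk-monotone : ∀ {X} (R : CycleWalk X) → 2 ≤ p R → Forward R ⊎ Backward R
  walk-monotone R le with walk-step R (≤-trans (s≤s z≤n) le) zero
  ... | inj₁ f0 = inj₁ (next-induction (λ t → vertex R (next t) ≡ succ (vertex R t)) stF zero f0)
    where
    stF : ∀ t → vertex R (next t) ≡ succ (vertex R t) → vertex R (next (next t)) ≡ succ (vertex R (next t))
    stF t f with walk-step R (≤-trans (s≤s z≤n) le) (next t)
    ... | inj₁ f' = f'
    ... | inj₂ b' = ⊥-elim (next²≢id le t (vertex-injective R (sym (succ-injective (trans (sym f) b')))))
  ... | inj₂ b0 = inj₂ (next-induction (λ t → vertex R t ≡ succ (vertex R (next t))) stB zero b0)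
    where
    stB : ∀ t → vertex R t ≡ succ (vertex R (next t)) → vertex R (next t) ≡ succ (vertex R (next (next t)))
    stB t b with walk-step R (≤-trans (s≤s z≤n) le) (next t)
    ... | inj₂ b' = b'
    ... | inj₁ f' = ⊥-elim (next²≢id le t (sym (vertex-injective R (trans b (sym f')))))

  longWalk-onto : ∀ {X} (R : CycleWalk X) → 2 ≤ p R → ∀ x → ∃ λ t → vertex R t ≡ x
  longWalk-onto R long x = let t , e = onWalk (position x) in t , trans e (ordering-position x)
    where
    OnWalk : V → Set
    OnWalk i = ∃ λ t → vertex R t ≡ ordering i
    start : OnWalk (position (vertex R zero))
    start = zero , sym (ordering-position _)
    onWalk : ∀ i → OnWalk i
    onWalk with walk-monotone R long
    ... | inj₁ forward = next-induction OnWalk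
            (λ i (t , e) → next t , trans (forward t) (trans (cong succ e) (succ-ordering i))) _ start
    ... | inj₂ backward = next-backward-induction OnWalk
            (λ i (t , e) → next t , trans (sym (ordering-position _))
                                    (cong ordering (sym (next-injective (ordering-injective (trans (sym e) (backward t)))))))
            _ start

  longWalk-spanning : ∀ {X} (R : CycleWalk X) → 2 ≤ p R → ∀ x → VertexOf ends X x
  longWalk-spanning R le x with longWalk-onto R le x
  ... | t , refl = walk-vertexOf R t

  succEdge-on-longWalk : ∀ {X} (R : CycleWalk X) → 2 ≤ p R → ∀ {g a} → Joins ends g a (succ a) →
            ∃ λ t → Joins ends g (vertex R t) (vertex R (next t))
  succEdge-on-longWalk R le {g} {a} j with walk-monotone R le | longWalk-onto R le a
  ... | inj₁ fw | t , e = t , subst₂ (Joins ends g) (sym e) (sym (trans (fw t) (cong succ e))) j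
  ... | inj₂ bw | s , e = prev s , subst₂ (Joins ends g)
      (sym (trans (bw (prev s)) (cong succ (trans (cong (vertex R) (next-prev s)) e))))
                                    (sym (trans (cong (vertex R) (next-prev s)) e)) (joins-sym j)

  nonLoop-on-longWalk : ∀ {X} (R : CycleWalk X) → 2 ≤ p R → ∀ {g a b} → Joins ends g a b → a ≢ b →
            ∃ λ t → Joins ends g (vertex R t) (vertex R (next t))
  nonLoop-on-longWalk R le {g} {a} {b} j ne with joins⇒succ j ne
  ... | inj₁ e = succEdge-on-longWalk R le (subst (Joins ends g a) e j)
  ... | inj₂ e = succEdge-on-longWalk R le (subst (Joins ends g b) e (joins-sym j))

  theta-family : ∀ {X g} (R : CycleWalk X) → 1 ≤ p R → g ∉ X → ∀ j → Joins ends g (vertex R j) (vertex R (next j)) →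
                 Family (X ∪ ⁅ g ⁆)
  theta-family {X} {g} R le g∉ j jg = inj₂ (inj₁ (parallelChord⇒theta R le g∉ j jg , (⁅ edge R j ⁆ ∪ ⁅ g ⁆) , sub
      , walk⇒cycle D , short⇒unbalanced D (s≤s (s≤s z≤n))))
    where
    D = digonWalk (λ e → g∉ (subst (_∈ X) e (edge∈ R j))) (λ e → next≢id le j (sym (vertex-injective R e))) (joins R j) jg
    sub : ⁅ edge R j ⁆ ∪ ⁅ g ⁆ ⊆ X ∪ ⁅ g ⁆
    sub f∈ with x∈p∪q⁻ ⁅ edge R j ⁆ ⁅ g ⁆ f∈
    ... | inj₁ h = x∈p∪q⁺ (inj₁ (subst (_∈ X) (sym (x∈⁅y⁆⇒x≡y _ h)) (edge∈ R j)))
    ... | inj₂ h = x∈p∪q⁺ (inj₂ h)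

  digons-meet : ∀ {g₁ g₁' a b g₂ g₂' c d} (gg₁ : g₁ ≢ g₁') (ab : a ≢ b) (j₁ : Joins ends g₁ a b) (j₁' : Joins ends g₁' a b)
             (gg₂ : g₂ ≢ g₂') (cd : c ≢ d) (j₂ : Joins ends g₂ c d) (j₂' : Joins ends g₂' c d) →
             g₂ ≢ g₁ → g₂ ≢ g₁' → MeetAtMostOnce (⁅ g₁ ⁆ ∪ ⁅ g₁' ⁆) (⁅ g₂ ⁆ ∪ ⁅ g₂' ⁆)
  digons-meet gg₁ ab j₁ j₁' gg₂ cd j₂ j₂' n1 n2 x y vx1 vx2 vy1 vy2 with x Fin.≟ y
  ... | yes e = e
  ... | no ne =
    let ax = digon-vertexOf gg₁ ab j₁ j₁' vx1 ; ay = digon-vertexOf gg₁ ab j₁ j₁' vy1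
        cx = digon-vertexOf gg₂ cd j₂ j₂' vx2 ; cy = digon-vertexOf gg₂ cd j₂ j₂' vy2
    in ⊥-elim (¬threeParallel (joins-between j₁ ax ay ne) (joins-between j₁' ax ay ne) (joins-between j₂ cx cy ne)
        gg₁ (λ e → n1 (sym e)) (λ e → n2 (sym e)))

  module _ {u v : V} where
    open Path

    data PathShape (P : Path ends u v) : Set where
      direct : (h : E) → Joins ends h u v → OnPathE ends P h → (∀ f → OnPathE ends P f → f ≡ h) → PathShape P
      detour : (x : V) → x ≢ u → x ≢ v → OnPathV ends P x → (x ≡ succ u) ⊎ (u ≡ succ x) → 2 ≤ len P → PathShape P

    pathShape : u ≢ v → (P : Path ends u v) → PathShape P
    pathShape uv record { len = zero ; start = s ; end = e } = ⊥-elim (uv (trans (sym s) e))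
    pathShape uv P@record { len = suc zero ; vtx = vt ; edg = ed ; start = s ; end = e ; step = st } =
      direct (ed zero) (subst₂ (Joins ends (ed zero)) s e (st zero)) (zero , refl) (λ { f (zero , r) → sym r })
    pathShape uv P@record { len = suc (suc l) ; vtx = vt ; edg = ed ; start = s ; end = e ; vinj = vi ; step = st } =
      detour (vt (suc zero)) (λ r → lem1 (vi _ _ (trans r (sym s)))) (λ r → lem2 l (vi _ _ (trans r (sym e))))
           (suc zero , refl) (joins⇒succ (subst (λ z → Joins ends (ed zero) z (vt (suc zero))) s (st zero))
             (λ r → lem1 (vi _ _ (trans (sym r) (sym s))))) (s≤s (s≤s z≤n))
      where
      lem1 : _≢_ {A = Fin (suc (suc (suc l)))} (suc zero) zero
      lem1 ()
      lem2 : ∀ l → _≢_ {A = Fin (suc (suc (suc l)))} (suc zero) (fromℕ (suc (suc l)))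
      lem2 l ()

  record ThetaShape (C : Subset m) : Set where
    field
      X       : Subset m
      R       : CycleWalk X
      long    : 2 ≤ p R
      q       : E
      q∉X     : q ∉ X
      j₀      : Fin (suc (p R))
      q-chord : Joins ends q (vertex R j₀) (vertex R (next j₀))
      C⊆X+q   : ∀ {f} → f ∈ C → f ∈ X ⊎ f ≡ q
      X⊆C     : X ⊆ C
      q∈C     : q ∈ C

  mkThetaShape : ∀ {C u v} (uv : u ≢ v) (Ps Pt Pl : Path ends u v) {hs ht : E} →
    Joins ends hs u v → (∀ f → OnPathE ends Ps f → f ≡ hs) → OnPathE ends Ps hs →
    Joins ends ht u v → (∀ f → OnPathE ends Pt f → f ≡ ht) → OnPathE ends Pt ht →
    2 ≤ Path.len Pl → hs ≢ ht → (∀ i → Path.edg Pl i ≢ hs) → (∀ i → Path.edg Pl i ≢ ht) →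
    (∀ {f} → f ∈ C → OnPathE ends Ps f ⊎ OnPathE ends Pt f ⊎ OnPathE ends Pl f) →
    (∀ {f} → OnPathE ends Ps f ⊎ OnPathE ends Pt f ⊎ OnPathE ends Pl f → f ∈ C) → ThetaShape C
  mkThetaShape {C} {u} {v} uv Ps Pt Pl {hs} {ht} jhs hsOnly hsOn jht htOnly htOn le2 hsht nls nlt toP fromP = record
    { X = image (closingEdges Pl hs) ; R = cycle ; long = le2 ; q = ht ; q∉X = ht∉X ; j₀ = fromℕ (Path.len Pl)
    ; q-chord = subst₂ (Joins ends ht) (sym (Path.end Pl))
                       (trans (sym (Path.start Pl)) (cong (Path.vtx Pl) (sym (next-fromℕ (Path.len Pl))))) (joins-sym jht)
    ; C⊆X+q = C⊆X+ht ; X⊆C = X⊆C′ ; q∈C = fromP (inj₂ (inj₁ htOn)) }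
    where
    cycle = closePath Pl (joins-sym jhs) nls
    ht∉X : ht ∉ image (closingEdges Pl hs)
    ht∉X h∈ with ∈-image⁻ (closingEdges Pl hs) h∈
    ... | t , e with closingEdges-cases Pl hs t
    ... | inj₁ e' = hsht (trans (sym e') e)
    ... | inj₂ (i , e') = nlt i (trans (sym e') e)
    C⊆X+ht : ∀ {f} → f ∈ C → f ∈ image (closingEdges Pl hs) ⊎ f ≡ ht
    C⊆X+ht f∈ with toP f∈
    ... | inj₁ o = inj₁ (subst (_∈ image (closingEdges Pl hs)) (trans (closingEdges-fromℕ Pl hs) (sym (hsOnly _ o)))
        (∈-image⁺ _ _))
    ... | inj₂ (inj₁ o) = inj₂ (htOnly _ o)
    ... | inj₂ (inj₂ (i , refl)) = inj₁ (subst (_∈ image (closingEdges Pl hs)) (closingEdges-inject₁ Pl hs i) (∈-image⁺ _ _))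
    X⊆C′ : image (closingEdges Pl hs) ⊆ C
    X⊆C′ f∈ with ∈-image⁻ (closingEdges Pl hs) f∈
    ... | t , refl with closingEdges-cases Pl hs t
    ... | inj₁ e' = subst (_∈ C) (sym e') (fromP (inj₁ hsOn))
    ... | inj₂ (i , e') = subst (_∈ C) (sym e') (fromP (inj₂ (inj₂ (i , refl))))

  Neighbour : V → V → Set
  Neighbour u x = (x ≡ succ u) ⊎ (u ≡ succ x)

  ¬threeNeighbours : ∀ {u x y z} → Neighbour u x → Neighbour u y → Neighbour u z → x ≢ y → x ≢ z → y ≢ z → ⊥
  ¬threeNeighbours (inj₁ a) (inj₁ b) _ xy _ _ = xy (trans a (sym b))
  ¬threeNeighbours (inj₂ a) (inj₂ b) _ xy _ _ = xy (succ-injective (trans (sym a) b))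
  ¬threeNeighbours (inj₁ a) (inj₂ b) (inj₁ c) _ xz _ = xz (trans a (sym c))
  ¬threeNeighbours (inj₁ a) (inj₂ b) (inj₂ c) _ _ yz = yz (succ-injective (trans (sym b) c))
  ¬threeNeighbours (inj₂ a) (inj₁ b) (inj₁ c) _ _ yz = yz (trans b (sym c))
  ¬threeNeighbours (inj₂ a) (inj₁ b) (inj₂ c) _ xz _ = xz (succ-injective (trans (sym a) c))

  interiors-distinct : ∀ {u v} {P Q : Path ends u v} → (∀ x → OnPathV ends P x → OnPathV ends Q x → (x ≡ u) ⊎ (x ≡ v)) →
         ∀ x y → x ≢ u → x ≢ v → OnPathV ends P x → OnPathV ends Q y → x ≢ y
  interiors-distinct vd x y xu xv ox oy refl with vd x ox oy
  ... | inj₁ e = xu e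
  ... | inj₂ e = xv e

  -- Every vertex has only two neighbours and every parallel class at most two edges, so exactly two of the
  -- three paths are single edges: a theta is a long cycle together with a chord parallel to one of its edges.
  theta-shape : ∀ {C} → IsTheta ends C → ThetaShape C
  theta-shape {C} (u , v , P₁ , P₂ , P₃ , uv , (e12 , v12) , (e13 , v13) , (e23 , v23) , iff)
    with pathShape uv P₁ | pathShape uv P₂ | pathShape uv P₃
  ... | direct h₁ j₁ o₁ on₁ | direct h₂ j₂ o₂ on₂ | direct h₃ j₃ o₃ on₃ =
    ⊥-elim (¬threeParallel j₁ j₂ j₃ (λ e → e12 h₁ o₁ (subst (OnPathE ends P₂) (sym e) o₂))
                           (λ e → e13 h₁ o₁ (subst (OnPathE ends P₃) (sym e) o₃))
                           (λ e → e23 h₂ o₂ (subst (OnPathE ends P₃) (sym e) o₃)))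
  ... | direct h₁ j₁ o₁ on₁ | direct h₂ j₂ o₂ on₂ | detour x xu xv ox nx' le =
    mkThetaShape uv P₁ P₂ P₃ j₁ on₁ o₁ j₂ on₂ o₂ le (λ e → e12 h₁ o₁ (subst (OnPathE ends P₂) (sym e) o₂))
      (λ i e → e13 h₁ o₁ (i , e)) (λ i e → e23 h₂ o₂ (i , e))
      (λ {f} f∈ → to (iff f) f∈) (λ {f} o → from (iff f) o)
  ... | direct h₁ j₁ o₁ on₁ | detour x xu xv ox nx' le | direct h₃ j₃ o₃ on₃ =
    mkThetaShape uv P₁ P₃ P₂ j₁ on₁ o₁ j₃ on₃ o₃ le (λ e → e13 h₁ o₁ (subst (OnPathE ends P₃) (sym e) o₃))
      (λ i e → e12 h₁ o₁ (i , e)) (λ i e → e23 (Path.edg P₂ i) (i , refl) (subst (OnPathE ends P₃) (sym e) o₃))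
      (λ {f} f∈ → sw (to (iff f) f∈)) (λ {f} o → from (iff f) (sw o))
    where
    sw : ∀ {A B' D : Set} → A ⊎ B' ⊎ D → A ⊎ D ⊎ B'
    sw (inj₁ a) = inj₁ a
    sw (inj₂ (inj₁ b)) = inj₂ (inj₂ b)
    sw (inj₂ (inj₂ d)) = inj₂ (inj₁ d)
  ... | detour x xu xv ox nx' le | direct h₂ j₂ o₂ on₂ | direct h₃ j₃ o₃ on₃ =
    mkThetaShape uv P₂ P₃ P₁ j₂ on₂ o₂ j₃ on₃ o₃ le (λ e → e23 h₂ o₂ (subst (OnPathE ends P₃) (sym e) o₃))
      (λ i e → e12 (Path.edg P₁ i) (i , refl) (subst (OnPathE ends P₂) (sym e) o₂))
      (λ i e → e13 (Path.edg P₁ i) (i , refl) (subst (OnPathE ends P₃) (sym e) o₃))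
      (λ {f} f∈ → rot3 (to (iff f) f∈)) (λ {f} o → from (iff f) (rot3' o))
    where
    rot3 : ∀ {A B' D : Set} → A ⊎ B' ⊎ D → B' ⊎ D ⊎ A
    rot3 (inj₁ a) = inj₂ (inj₂ a)
    rot3 (inj₂ (inj₁ b)) = inj₁ b
    rot3 (inj₂ (inj₂ d)) = inj₂ (inj₁ d)
    rot3' : ∀ {A B' D : Set} → B' ⊎ D ⊎ A → A ⊎ B' ⊎ D
    rot3' (inj₁ b) = inj₂ (inj₁ b)
    rot3' (inj₂ (inj₁ d)) = inj₂ (inj₂ d)
    rot3' (inj₂ (inj₂ a)) = inj₁ a
  ... | direct h₁ j₁ o₁ on₁ | detour x xu xv ox nx₂ _ | detour y yu yv oy ny₃ _ =
    ⊥-elim (¬threeNeighbours (joins⇒succ j₁ uv) nx₂ ny₃ (λ e → xv (sym e)) (λ e → yv (sym e))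
                             (interiors-distinct {P = P₂} {Q = P₃} v23 x y xu xv ox oy))
  ... | detour x xu xv ox nx₁ _ | direct h₂ j₂ o₂ on₂ | detour y yu yv oy ny₃ _ =
    ⊥-elim (¬threeNeighbours (joins⇒succ j₂ uv) nx₁ ny₃ (λ e → xv (sym e)) (λ e → yv (sym e))
                             (interiors-distinct {P = P₁} {Q = P₃} v13 x y xu xv ox oy))
  ... | detour x xu xv ox nx₁ _ | detour y yu yv oy ny₂ _ | direct h₃ j₃ o₃ on₃ =
    ⊥-elim (¬threeNeighbours (joins⇒succ j₃ uv) nx₁ ny₂ (λ e → xv (sym e)) (λ e → yv (sym e))
                             (interiors-distinct {P = P₁} {Q = P₂} v12 x y xu xv ox oy))
  ... | detour x xu xv ox nx₁ _ | detour y yu yv oy ny₂ _ | detour z zu zv oz nz₃ _ =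
    ⊥-elim (¬threeNeighbours nx₁ ny₂ nz₃ (interiors-distinct {P = P₁} {Q = P₂} v12 x y xu xv ox oy)
                             (interiors-distinct {P = P₁} {Q = P₃} v13 x z xu xv ox oz)
                             (interiors-distinct {P = P₂} {Q = P₃} v23 y z yu yv oy oz))

  thirdVertex : ∀ {a b} → (b ≡ succ a) ⊎ (a ≡ succ b) → ∃ λ c → c ≢ a × c ≢ b
  thirdVertex {a} (inj₁ refl) = succ (succ a) , succ²≢id a , (λ e → succ≢id a (succ-injective e))
  thirdVertex {a} {b} (inj₂ refl) = succ (succ b) , succ≢id (succ b) , succ²≢id b

  ¬family⊆loop : ∀ {D ℓ a} → Joins ends ℓ a a → Family D → ¬ D ⊆ ⁅ ℓ ⁆
  ¬family⊆loop {D} {a = a} loop (inj₁ (_ , balanced)) D⊆ℓ =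
    let f , f∈D , inc = proj₂ (hamB D balanced) (succ a)
    in [ succ≢id a , succ≢id a ]′ (incident⇒endpoint (subst (λ g → Joins ends g a a) (sym (x∈⁅y⁆⇒x≡y _ (D⊆ℓ f∈D))) loop) inc)
  ¬family⊆loop loop (inj₂ (inj₁ ((u , v , P₁ , _ , _ , u≢v , _ , _ , _ , D≡) , _))) D⊆ℓ =
    let f , on₁ , nonLoop , _ = path-firstEdge u≢v P₁
    in loop⇒¬nonLoop loop (subst NonLoop (x∈⁅y⁆⇒x≡y _ (D⊆ℓ (from (D≡ f) (inj₁ on₁)))) nonLoop)
  ¬family⊆loop {ℓ = ℓ} loop (inj₂ (inj₂ (X₁ , X₂ , (cyc₁ , _) , (cyc₂ , _) , X₁≢X₂ , _ , refl))) D⊆ℓ =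
    X₁≢X₂ (trans (fills cyc₁ (λ h → D⊆ℓ (x∈p∪q⁺ (inj₁ h)))) (sym (fills cyc₂ (λ h → D⊆ℓ (x∈p∪q⁺ (inj₂ h))))))
    where
    fills : ∀ {X} → IsCycle ends X → X ⊆ ⁅ ℓ ⁆ → X ≡ ⁅ ℓ ⁆
    fills {X} cyc X⊆ℓ = let f , f∈X = cycle-nonempty cyc in
      ⊆-antisym X⊆ℓ (λ h → subst (_∈ X) (trans (x∈⁅y⁆⇒x≡y _ (X⊆ℓ f∈X)) (sym (x∈⁅y⁆⇒x≡y _ h))) f∈X)

  ¬family⊆digon : ∀ {D g g′ a b} → g ≢ g′ → a ≢ b → Joins ends g a b → Joins ends g′ a b → Family D →
                  ¬ D ⊆ ⁅ g ⁆ ∪ ⁅ g′ ⁆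
  ¬family⊆digon {D} g≢g′ a≢b jg jg′ (inj₁ (_ , balanced)) D⊆ with thirdVertex (joins⇒succ jg a≢b)
  ... | x , x≢a , x≢b with proj₂ (hamB D balanced) x
  ... | f , f∈D , inc with x∈⁅y⁆∪⁅z⁆⇒x≡y⊎x≡z (D⊆ f∈D)
  ... | inj₁ refl = [ x≢a , x≢b ]′ (incident⇒endpoint jg inc)
  ... | inj₂ refl = [ x≢a , x≢b ]′ (incident⇒endpoint jg′ inc)
  ¬family⊆digon {g = g} {g′} _ _ _ _
      (inj₂ (inj₁ ((u , v , P₁ , P₂ , P₃ , u≢v , (P₁∩P₂ , _) , (P₁∩P₃ , _) , (P₂∩P₃ , _) , D≡) , _))) D⊆ =
    let f₁ , on₁ , _ = path-firstEdge u≢v P₁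
        f₂ , on₂ , _ = path-firstEdge u≢v P₂
        f₃ , on₃ , _ = path-firstEdge u≢v P₃
    in ¬three⊆two (x∈⁅y⁆∪⁅z⁆⇒x≡y⊎x≡z (D⊆ (from (D≡ f₁) (inj₁ on₁))))
                  (x∈⁅y⁆∪⁅z⁆⇒x≡y⊎x≡z (D⊆ (from (D≡ f₂) (inj₂ (inj₁ on₂)))))
                  (x∈⁅y⁆∪⁅z⁆⇒x≡y⊎x≡z (D⊆ (from (D≡ f₃) (inj₂ (inj₂ on₃)))))
                  (λ e → P₁∩P₂ f₁ on₁ (subst (OnPathE ends P₂) (sym e) on₂))
                  (λ e → P₁∩P₃ f₁ on₁ (subst (OnPathE ends P₃) (sym e) on₃))
                  (λ e → P₂∩P₃ f₂ on₂ (subst (OnPathE ends P₃) (sym e) on₃))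
    where
    ¬three⊆two : ∀ {x y z} → (x ≡ g) ⊎ (x ≡ g′) → (y ≡ g) ⊎ (y ≡ g′) → (z ≡ g) ⊎ (z ≡ g′) → x ≢ y → x ≢ z → y ≢ z → ⊥
    ¬three⊆two (inj₁ refl) (inj₁ refl) _ x≢y _ _ = x≢y refl
    ¬three⊆two (inj₂ refl) (inj₂ refl) _ x≢y _ _ = x≢y refl
    ¬three⊆two (inj₁ refl) (inj₂ refl) (inj₁ refl) _ x≢z _ = x≢z refl
    ¬three⊆two (inj₁ refl) (inj₂ refl) (inj₂ refl) _ _ y≢z = y≢z refl
    ¬three⊆two (inj₂ refl) (inj₁ refl) (inj₁ refl) _ _ y≢z = y≢z refl
    ¬three⊆two (inj₂ refl) (inj₁ refl) (inj₂ refl) _ x≢z _ = x≢z refl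
  ¬family⊆digon {g = g} {g′} g≢g′ a≢b jg jg′ (inj₂ (inj₂ (X₁ , X₂ , (cyc₁ , _) , (cyc₂ , _) , X₁≢X₂ , _ , refl))) D⊆ =
    X₁≢X₂ (trans (fills cyc₁ (λ h → D⊆ (x∈p∪q⁺ (inj₁ h)))) (sym (fills cyc₂ (λ h → D⊆ (x∈p∪q⁺ (inj₂ h))))))
    where
    nonLoop : ∀ {f} → (f ≡ g) ⊎ (f ≡ g′) → NonLoop f
    nonLoop (inj₁ refl) = joins⇒nonLoop jg a≢b
    nonLoop (inj₂ refl) = joins⇒nonLoop jg′ a≢b
    both : ∀ {X x y} → x ∈ X → y ∈ X → x ≢ y → (x ≡ g) ⊎ (x ≡ g′) → (y ≡ g) ⊎ (y ≡ g′) → g ∈ X × g′ ∈ X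
    both x∈ y∈ x≢y (inj₁ refl) (inj₁ refl) = ⊥-elim (x≢y refl)
    both x∈ y∈ x≢y (inj₁ refl) (inj₂ refl) = x∈ , y∈
    both x∈ y∈ x≢y (inj₂ refl) (inj₁ refl) = y∈ , x∈
    both x∈ y∈ x≢y (inj₂ refl) (inj₂ refl) = ⊥-elim (x≢y refl)
    fills : ∀ {X} → IsCycle ends X → X ⊆ ⁅ g ⁆ ∪ ⁅ g′ ⁆ → X ≡ ⁅ g ⁆ ∪ ⁅ g′ ⁆
    fills {X} cyc X⊆ with cycle⇒walk cyc
    ... | R with 1 ≤? p R
    ... | no trivial = ⊥-elim (loop⇒¬nonLoop
            (subst (λ z → Joins ends (edge R zero) (vertex R zero) (vertex R z)) (next≡id trivial zero) (joins R zero))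
            (nonLoop (x∈⁅y⁆∪⁅z⁆⇒x≡y⊎x≡z (X⊆ (edge∈ R zero)))))
    ... | yes nontrivial =
      let g∈X , g′∈X = both (edge∈ R zero) (edge∈ R (next zero)) (λ e → next≢id nontrivial zero (sym (edge-injective R e)))
                            (x∈⁅y⁆∪⁅z⁆⇒x≡y⊎x≡z (X⊆ (edge∈ R zero))) (x∈⁅y⁆∪⁅z⁆⇒x≡y⊎x≡z (X⊆ (edge∈ R (next zero))))
      in ⊆-antisym X⊆ λ h → [ (λ e → subst (_∈ X) (sym e) g∈X) , (λ e → subst (_∈ X) (sym e) g′∈X) ]′ (x∈⁅y⁆∪⁅z⁆⇒x≡y⊎x≡z h)

  baseEdge : V → E
  baseEdge i = proj₁ (edgeAt i)

  baseWalk : CycleWalk (image baseEdge)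
  baseWalk = record { p = N ; vertex = ordering ; edge = baseEdge ; vertex-injective = ordering-injective ; edge-injective = ei
      ; joins = λ i → proj₂ (edgeAt i) ; edge-onto = ∈-image⁻ baseEdge ; edge∈ = ∈-image⁺ baseEdge }
    where
    ei : ∀ {i j} → baseEdge i ≡ baseEdge j → i ≡ j
    ei {i} {j} e with joins-endpoints (proj₂ (edgeAt i))
        (subst (λ z → Joins ends z (ordering j) (ordering (next j))) (sym e) (proj₂ (edgeAt j)))
    ... | inj₁ (a , _) = ordering-injective a
    ... | inj₂ (a , b) = ⊥-elim
        (next²≢id (s≤s (s≤s z≤n)) j (trans (cong next (sym (ordering-injective a))) (ordering-injective b)))

  -- A Hamiltonian path plus a loop, or plus a second edge parallel to its first edge, is independent.
  module SpanningPath (vtx : Fin (suc N) → V) (edg : Fin (suc N) → E)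
                (vtx-inj : ∀ {i j} → vtx i ≡ vtx j → i ≡ j) (edg-inj : ∀ {i j} → edg i ≡ edg j → i ≡ j)
                (step : ∀ t → Joins ends (edg t) (vtx t) (vtx (next t))) where

    data ExtraEdge : E → Set where
      extraLoop : ∀ {ℓ a} → Joins ends ℓ a a → ExtraEdge ℓ
      extraParallel  : ∀ {g'} → g' ≢ edg zero → Joins ends g' (vtx zero) (vtx (next zero)) → ExtraEdge g'

    pathEdge : Fin N → E
    pathEdge t = edg (inject₁ t)

    pathEdge-joins : ∀ t → Joins ends (pathEdge t) (vtx (inject₁ t)) (vtx (suc t))
    pathEdge-joins t = subst (λ z → Joins ends (pathEdge t) (vtx (inject₁ t)) (vtx z)) (next-inject₁ t) (step (inject₁ t))

    pathEdge-nonLoop : ∀ t → NonLoop (pathEdge t)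
    pathEdge-nonLoop t = joins⇒nonLoop (pathEdge-joins t) (λ e → inject₁≢suc t (vtx-inj e))

    Excluded : ∀ {x} → ExtraEdge x → Fin N → Set
    Excluded (extraLoop _) t = Unit.⊤
    Excluded (extraParallel _ _) t = t ≢ zero

    pathPlus : E → Subset m
    pathPlus x = image pathEdge ∪ ⁅ x ⁆

    excluded-next : ∀ {x} (ex : ExtraEdge x) (t' t : Fin N) → toℕ t' ≡ suc (toℕ t) → Excluded ex t'
    excluded-next (extraLoop _) t' t e = Unit.tt
    excluded-next (extraParallel _ _) t' t e refl = 0≢1+n e

    extra-notAtNext : ∀ {x} (ex : ExtraEdge x) t → Excluded ex t → NonLoop x → Incident ends x (vtx (suc t)) → ⊥
    extra-notAtNext (extraLoop j) t _ nl _ = loop⇒¬nonLoop j nl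
    extra-notAtNext (extraParallel _ jx) t excluded _ inc with incident⇒endpoint jx inc
    ... | inj₁ e = Fin.0≢1+n (sym (vtx-inj e))
    ... | inj₂ e = excluded (Fin.suc-injective (vtx-inj e))

    -- The last excluded path edge in D would be pendant at its far end.
    excluded∉family : ∀ {x} (ex : ExtraEdge x) {D} → Family D → D ⊆ pathPlus x → ∀ t → Excluded ex t → pathEdge t ∉ D
    excluded∉family {x} ex {D} famD D⊆ = downward-induction (λ t → Excluded ex t → pathEdge t ∉ D) peel
      where
      peel : ∀ t → (∀ t' → toℕ t' ≡ suc (toℕ t) → Excluded ex t' → pathEdge t' ∉ D) → Excluded ex t → pathEdge t ∉ D
      peel t later excluded t∈D
        with family-noPendant famD (pathEdge t) t∈D (pathEdge-nonLoop t) (vtx (suc t)) (joins⇒incidentʳ (pathEdge-joins t))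
      ... | g′ , g′∈D , g′≢ , g′-nonLoop , g′-inc with x∈p∪q⁻ (image pathEdge) ⁅ x ⁆ (D⊆ g′∈D)
      ... | inj₂ g′∈⁅x⁆ rewrite x∈⁅y⁆⇒x≡y _ g′∈⁅x⁆ = extra-notAtNext ex t excluded g′-nonLoop g′-inc
      ... | inj₁ g′∈path with ∈-image⁻ pathEdge g′∈path
      ...   | t′ , refl with incident⇒endpoint (pathEdge-joins t′) g′-inc
      ...     | inj₂ e = g′≢ (cong pathEdge (Fin.suc-injective (sym (vtx-inj e))))
      ...     | inj₁ e = later t′ t′-next (excluded-next ex t′ t t′-next) g′∈D
        where
        t′-next : toℕ t′ ≡ suc (toℕ t)
        t′-next = trans (sym (Fin.toℕ-inject₁ t′)) (cong toℕ (sym (vtx-inj e)))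

    extra≢pathEdge : ∀ {x} (ex : ExtraEdge x) s → x ≢ pathEdge s
    extra≢pathEdge (extraLoop j) s e = loop⇒¬nonLoop j (subst NonLoop (sym e) (pathEdge-nonLoop s))
    extra≢pathEdge (extraParallel x≢ jx) s e
      with joins-endpoints jx (subst (λ z → Joins ends z (vtx (inject₁ s)) (vtx (suc s))) (sym e) (pathEdge-joins s))
    ... | inj₁ (e₀ , _) = x≢ (trans e (cong edg (sym (vtx-inj e₀))))
    ... | inj₂ (e₀ , _) = Fin.0≢1+n (vtx-inj e₀)

    listing : E → Fin (suc N) → E
    listing x t with lastView t
    ... | last = x
    ... | inner s = pathEdge s

    listing-injective : ∀ {x} (ex : ExtraEdge x) {i j} → listing x i ≡ listing x j → i ≡ j
    listing-injective ex {i} {j} e with lastView i | lastView j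
    ... | last | last = refl
    ... | last | inner b = ⊥-elim (extra≢pathEdge ex b e)
    ... | inner a | last = ⊥-elim (extra≢pathEdge ex a (sym e))
    ... | inner a | inner b = cong inject₁ (Fin.inject₁-injective (edg-inj e))

    listing∈ : ∀ x t → listing x t ∈ pathPlus x
    listing∈ x t with lastView t
    ... | last = x∈p∪q⁺ (inj₂ (x∈⁅x⁆ x))
    ... | inner s = x∈p∪q⁺ (inj₁ (∈-image⁺ pathEdge s))

    pathPlus-size : ∀ {x} (ex : ExtraEdge x) → suc N ≤ ∣ pathPlus x ∣
    pathPlus-size {x} ex = injective⇒≤∣∣ (listing x) (listing-injective ex) (pathPlus x) (listing∈ x)

    pathPlus-independent : ∀ {x} (ex : ExtraEdge x) → Independent ends B (pathPlus x)
    pathPlus-independent {x} ex@(extraLoop loop) C (famC , _) C⊆ = ¬family⊆loop loop famC only-x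
      where
      only-x : C ⊆ ⁅ x ⁆
      only-x f∈ with x∈p∪q⁻ (image pathEdge) ⁅ x ⁆ (C⊆ f∈)
      ... | inj₂ f∈⁅x⁆ = f∈⁅x⁆
      ... | inj₁ f∈path with ∈-image⁻ pathEdge f∈path
      ... | t , refl = ⊥-elim (excluded∉family ex famC C⊆ t Unit.tt f∈)
    pathPlus-independent {x} ex@(extraParallel x≢ parallel) C (famC , _) C⊆ =
      ¬family⊆digon (≢-sym x≢) (λ e → next≢id (s≤s z≤n) zero (sym (vtx-inj e))) (step zero) parallel famC only-digon
      where
      only-digon : C ⊆ ⁅ edg zero ⁆ ∪ ⁅ x ⁆
      only-digon f∈ with x∈p∪q⁻ (image pathEdge) ⁅ x ⁆ (C⊆ f∈)
      ... | inj₂ f∈⁅x⁆ = x∈p∪q⁺ (inj₂ f∈⁅x⁆)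
      ... | inj₁ f∈path with ∈-image⁻ pathEdge f∈path
      ... | zero , refl = x∈p∪q⁺ (inj₁ (x∈⁅x⁆ _))
      ... | suc t , refl = ⊥-elim (excluded∉family ex famC C⊆ (suc t) (λ ()) f∈)

  cycle+loop-exchange : ∀ {C e y X′ ℓ′ b} (R′ : CycleWalk X′) → Joins ends ℓ′ b b → ℓ′ ∉ X′ →
                        Within C e X′ → Within C e ⁅ ℓ′ ⁆ → y ∉ X′ → y ≢ ℓ′ → ¬ ¬ ExchangeDependent C e y
  cycle+loop-exchange {X′ = X′} {ℓ′} R′ loop ℓ′∉X′ X′⊆ ℓ′⊆ y∉X′ y≢ℓ′ noExchange = ¬¬-excluded-middle {A = B X′} λ
    { (yes balanced) → exchange X′ (balanced-family R′ balanced) X′⊆ y∉X′ noExchange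
    ; (no unbalanced) → exchange (X′ ∪ ⁅ ℓ′ ⁆)
        (handcuff-family R′ (loopWalk loop) unbalanced (loop-unbalanced loop) (x∈q∧x∉p⇒p≢q (x∈⁅x⁆ ℓ′) ℓ′∉X′)
          (loop-meets loop))
        (∪-elim X′⊆ ℓ′⊆) (x∉p∧x∉q⇒x∉p∪q y∉X′ (x≢y⇒x∉⁅y⁆ y≢ℓ′)) noExchange }

  chord-exchange : ∀ {C e y X′ g} (R′ : CycleWalk X′) → 1 ≤ p R′ → g ∉ X′ → ∀ t →
                   Joins ends g (vertex R′ t) (vertex R′ (next t)) →
                   Within C e X′ → Within C e ⁅ g ⁆ → y ∉ X′ → y ≢ g → ¬ ¬ ExchangeDependent C e y
  chord-exchange {X′ = X′} {g} R′ nontrivial g∉X′ t chord X′⊆ g⊆ y∉X′ y≢g =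
    exchange (X′ ∪ ⁅ g ⁆) (theta-family R′ nontrivial g∉X′ t chord) (∪-elim X′⊆ g⊆)
      (x∉p∧x∉q⇒x∉p∪q y∉X′ (x≢y⇒x∉⁅y⁆ y≢g))

  module LoopHandcuff {X C : Subset m} (R : CycleWalk X) (long : 2 ≤ p R) {ℓ : E} {a : V} (loop : Joins ends ℓ a a)
                      (ℓ∉X : ℓ ∉ X) (C⊆X+ℓ : ∀ {f} → f ∈ C → f ∈ X ⊎ f ≡ ℓ) (X⊆C : X ⊆ C) (ℓ∈C : ℓ ∈ C) where

    nontrivial : 1 ≤ p R
    nontrivial = ≤-trans (s≤s z≤n) long

    edge≢ℓ : ∀ s → edge R s ≢ ℓ
    edge≢ℓ s r = ℓ∉X (subst (_∈ X) r (edge∈ R s))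

    module _ {e : E} (e∉C : e ∉ C) where

      e∉X : e ∉ X
      e∉X e∈X = e∉C (X⊆C e∈X)

      e≢ℓ : e ≢ ℓ
      e≢ℓ r = e∉C (subst (_∈ C) (sym r) ℓ∈C)

      edge≢e : ∀ s → edge R s ≢ e
      edge≢e s r = e∉X (subst (_∈ X) r (edge∈ R s))

      new-loop-for-loop : ∀ {b} → Joins ends e b b → ¬ ¬ ExchangeDependent C e ℓ
      new-loop-for-loop loopₑ = cycle+loop-exchange R loopₑ e∉X (within-⊆ X⊆C) within-new ℓ∉X (≢-sym e≢ℓ)

      new-loop-for-cycleEdge : ∀ {b y} → Joins ends e b b → y ∈ X → ¬ ¬ ExchangeDependent C e y
      new-loop-for-cycleEdge loopₑ y∈X = cycle+loop-exchange (loopWalk loop) loopₑ (x≢y⇒x∉⁅y⁆ e≢ℓ)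
        (within-old ℓ∈C) within-new (λ y∈ℓ → ℓ∉X (subst (_∈ X) (x∈⁅y⁆⇒x≡y _ y∈ℓ) y∈X)) (λ r → e∉X (subst (_∈ X) r y∈X))

      chord-for-loop : ∀ {t} → Joins ends e (vertex R t) (vertex R (next t)) → ¬ ¬ ExchangeDependent C e ℓ
      chord-for-loop {t} chord = chord-exchange R nontrivial e∉X t chord (within-⊆ X⊆C) within-new ℓ∉X (≢-sym e≢ℓ)

      chord-for-its-edge : ∀ {t} → Joins ends e (vertex R t) (vertex R (next t)) → ¬ ¬ ExchangeDependent C e (edge R t)
      chord-for-its-edge {t} chord = cycle+loop-exchange (replaceWalkEdge R t e edge≢e chord) loop
        (∉rerouted R t e (≢-sym e≢ℓ) ℓ∉X)
            (rerouted-all R t e {P = λ z → z ∈ C ⊎ z ≡ e} (λ s → inj₁ (X⊆C (edge∈ R s))) (inj₂ refl))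
        (within-old ℓ∈C) (removed∉rerouted R t e (edge≢e t)) (edge≢ℓ t)

      chord-for-other-edge : ∀ {s t} → Joins ends e (vertex R t) (vertex R (next t)) → s ≢ t →
                             ¬ ¬ ExchangeDependent C e (edge R s)
      chord-for-other-edge {s} {t} chord s≢t = cycle+loop-exchange (walk-digon R nontrivial t (edge≢e t) chord) loop
        (x≢y∧x≢z⇒x∉⁅y⁆∪⁅z⁆ (≢-sym (edge≢ℓ t)) (≢-sym e≢ℓ)) (∪-elim (within-old (X⊆C (edge∈ R t))) within-new)
        (within-old ℓ∈C) (x≢y∧x≢z⇒x∉⁅y⁆∪⁅z⁆ (λ r → s≢t (edge-injective R r)) (edge≢e s)) (edge≢ℓ s)

    exchanges : ∀ e → e ∉ C → ∀ y → y ∈ C → ¬ ¬ ExchangeDependent C e y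
    exchanges e e∉C y y∈C with loop⊎nonLoop e | C⊆X+ℓ y∈C
    ... | inj₁ (_ , loopₑ) | inj₂ refl = new-loop-for-loop e∉C loopₑ
    ... | inj₁ (_ , loopₑ) | inj₁ y∈X = new-loop-for-cycleEdge e∉C loopₑ y∈X
    ... | inj₂ (_ , _ , jₑ , nonLoopₑ) | y∈X+ℓ with nonLoop-on-longWalk R long jₑ nonLoopₑ | y∈X+ℓ
    ...   | t , chord | inj₂ refl = chord-for-loop e∉C chord
    ...   | t , chord | inj₁ y∈X with edge-onto R y∈X
    ...     | s , refl with s Fin.≟ t
    ...       | yes refl = chord-for-its-edge e∉C chord
    ...       | no s≢t = chord-for-other-edge e∉C chord s≢t

  module ThetaCircuit {C : Subset m} (shape : ThetaShape C) where
    open ThetaShape shape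

    nontrivial : 1 ≤ p R
    nontrivial = ≤-trans (s≤s z≤n) long

    edge≢q : ∀ s → edge R s ≢ q
    edge≢q s r = q∉X (subst (_∈ X) r (edge∈ R s))

    edge∈C : ∀ s → edge R s ∈ C
    edge∈C s = X⊆C (edge∈ R s)

    R₀ : CycleWalk (Rerouted R j₀ q)
    R₀ = replaceWalkEdge R j₀ q edge≢q q-chord

    R₀⊆C : Rerouted R j₀ q ⊆ C
    R₀⊆C = rerouted-all R j₀ q edge∈C q∈C

    digon₀ : CycleWalk (⁅ edge R j₀ ⁆ ∪ ⁅ q ⁆)
    digon₀ = walk-digon R nontrivial j₀ (edge≢q j₀) q-chord

    digon₀⊆C : ⁅ edge R j₀ ⁆ ∪ ⁅ q ⁆ ⊆ C
    digon₀⊆C = ∪-elim (λ z∈ → subst (_∈ C) (sym (x∈⁅y⁆⇒x≡y _ z∈)) (edge∈C j₀)) (λ z∈ → subst (_∈ C) (sym (x∈⁅y⁆⇒x≡y _ z∈)) q∈C)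

    module _ {e : E} (e∉C : e ∉ C) where

      e∉X : e ∉ X
      e∉X e∈X = e∉C (X⊆C e∈X)

      e≢q : e ≢ q
      e≢q r = e∉C (subst (_∈ C) (sym r) q∈C)

      edge≢e : ∀ s → edge R s ≢ e
      edge≢e s r = e∉X (subst (_∈ X) r (edge∈ R s))

      new-loop-for-chord : ∀ {b} → Joins ends e b b → ¬ ¬ ExchangeDependent C e q
      new-loop-for-chord loopₑ = cycle+loop-exchange R loopₑ e∉X (within-⊆ X⊆C) within-new q∉X (≢-sym e≢q)

      new-loop-for-chordEdge : ∀ {b} → Joins ends e b b → ¬ ¬ ExchangeDependent C e (edge R j₀)
      new-loop-for-chordEdge loopₑ = cycle+loop-exchange R₀ loopₑ (∉rerouted R j₀ q e≢q e∉X) (within-⊆ R₀⊆C)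
        within-new (removed∉rerouted R j₀ q (edge≢q j₀)) (edge≢e j₀)

      new-loop-for-other-edge : ∀ {b s} → Joins ends e b b → s ≢ j₀ → ¬ ¬ ExchangeDependent C e (edge R s)
      new-loop-for-other-edge {s = s} loopₑ s≢j₀ = cycle+loop-exchange digon₀ loopₑ
        (x≢y∧x≢z⇒x∉⁅y⁆∪⁅z⁆ (≢-sym (edge≢e j₀)) e≢q) (within-⊆ digon₀⊆C) within-new
        (x≢y∧x≢z⇒x∉⁅y⁆∪⁅z⁆ (λ r → s≢j₀ (edge-injective R r)) (edge≢q s)) (edge≢e s)

      module _ {t} (chord : Joins ends e (vertex R t) (vertex R (next t))) where

        chord-for-chord : ¬ ¬ ExchangeDependent C e q
        chord-for-chord = chord-exchange R nontrivial e∉X t chord (within-⊆ X⊆C) within-new q∉X (≢-sym e≢q)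

        chord-for-its-edge : ¬ ¬ ExchangeDependent C e (edge R t)
        chord-for-its-edge = chord-exchange (replaceWalkEdge R t e edge≢e chord) nontrivial
          (∉rerouted R t e (≢-sym e≢q) q∉X) j₀ q-chord
              (rerouted-all R t e {P = λ z → z ∈ C ⊎ z ≡ e} (λ s → inj₁ (edge∈C s)) (inj₂ refl))
          (within-old q∈C) (removed∉rerouted R t e (edge≢e t)) (edge≢q t)

        chord-for-chordEdge : ¬ ¬ ExchangeDependent C e (edge R j₀)
        chord-for-chordEdge = chord-exchange R₀ nontrivial (∉rerouted R j₀ q e≢q e∉X) t chord (within-⊆ R₀⊆C)
          within-new (removed∉rerouted R j₀ q (edge≢q j₀)) (edge≢e j₀)

        chord-for-other-edge : ∀ {s} → t ≢ j₀ → s ≢ t → s ≢ j₀ → ¬ ¬ ExchangeDependent C e (edge R s)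
        chord-for-other-edge {s} t≢j₀ s≢t s≢j₀ = exchange ((⁅ edge R j₀ ⁆ ∪ ⁅ q ⁆) ∪ (⁅ edge R t ⁆ ∪ ⁅ e ⁆))
          (handcuff-family digon₀ digonₜ (short⇒unbalanced digon₀ (s≤s (s≤s z≤n))) (short⇒unbalanced digonₜ (s≤s (s≤s z≤n)))
             (x∈q∧x∉p⇒p≢q (x∈p∪q⁺ (inj₁ (x∈⁅x⁆ (edge R t)))) (x≢y∧x≢z⇒x∉⁅y⁆∪⁅z⁆ (λ r → t≢j₀ (edge-injective R r)) (edge≢q t)))
             (digons-meet (edge≢q j₀) (walk-step-distinct R nontrivial j₀) (joins R j₀) q-chord
                          (edge≢e t) (walk-step-distinct R nontrivial t) (joins R t) chord
                          (λ r → t≢j₀ (edge-injective R r)) (edge≢q t)))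
          (∪-elim (within-⊆ digon₀⊆C) (∪-elim (within-old (edge∈C t)) within-new))
          (x∉p∧x∉q⇒x∉p∪q (x≢y∧x≢z⇒x∉⁅y⁆∪⁅z⁆ (λ r → s≢j₀ (edge-injective R r)) (edge≢q s))
                         (x≢y∧x≢z⇒x∉⁅y⁆∪⁅z⁆ (λ r → s≢t (edge-injective R r)) (edge≢e s)))
          where
          digonₜ : CycleWalk (⁅ edge R t ⁆ ∪ ⁅ e ⁆)
          digonₜ = walk-digon R nontrivial t (edge≢e t) chord

    exchanges : ∀ e → e ∉ C → ∀ y → y ∈ C → ¬ ¬ ExchangeDependent C e y
    exchanges e e∉C y y∈C with loop⊎nonLoop e | C⊆X+q y∈C
    ... | inj₁ (_ , loopₑ) | inj₂ refl = new-loop-for-chord e∉C loopₑ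
    ... | inj₁ (_ , loopₑ) | inj₁ y∈X with edge-onto R y∈X
    ...   | s , refl with s Fin.≟ j₀
    ...     | yes refl = new-loop-for-chordEdge e∉C loopₑ
    ...     | no s≢j₀ = new-loop-for-other-edge e∉C loopₑ s≢j₀
    exchanges e e∉C y y∈C | inj₂ (_ , _ , jₑ , nonLoopₑ) | y∈X+q with nonLoop-on-longWalk R long jₑ nonLoopₑ
    ... | t , chord with t Fin.≟ j₀
    ...   | yes refl = ⊥-elim (¬threeParallel (joins R j₀) q-chord chord (edge≢q j₀) (edge≢e e∉C j₀) (≢-sym (e≢q e∉C)))
    ...   | no t≢j₀ with y∈X+q
    ...     | inj₂ refl = chord-for-chord e∉C chord
    ...     | inj₁ y∈X with edge-onto R y∈X
    ...       | s , refl with s Fin.≟ t | s Fin.≟ j₀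
    ...         | yes refl | _ = chord-for-its-edge e∉C chord
    ...         | no _ | yes refl = chord-for-chordEdge e∉C chord
    ...         | no s≢t | no s≢j₀ = chord-for-other-edge e∉C chord t≢j₀ s≢t s≢j₀

  LargeIndependent : Set
  LargeIndependent = Σ (Subset m) λ I → Independent ends B I × suc N ≤ ∣ I ∣

  module BasePath = SpanningPath ordering baseEdge ordering-injective (edge-injective baseWalk) (joins baseWalk)

  loop⇒largeIndependent : ∀ {ℓ a} → Joins ends ℓ a a → LargeIndependent
  loop⇒largeIndependent loop =
    BasePath.pathPlus _ , BasePath.pathPlus-independent extra , BasePath.pathPlus-size extra
    where extra = BasePath.extraLoop loop

  spanningDigon⇒largeIndependent : ∀ {X} (R : CycleWalk X) → p R ≡ N → ∀ {g g′ a b} → g ≢ g′ →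
                                   Joins ends g a b → Joins ends g′ a b → ∀ t → edge R t ≡ g → LargeIndependent
  spanningDigon⇒largeIndependent R spanning {g} {g′} g≢g′ jg jg′ t edge≡g =
    digonAtZero (rotateWalk R (prev t)) spanning
        (trans (rotateWalk-edge-zero R (prev t)) (trans (cong (edge R) (next-prev t)) edge≡g))
    where
    digonAtZero : ∀ {X′} (H : CycleWalk X′) → p H ≡ N → edge H zero ≡ g → LargeIndependent
    digonAtZero record { vertex = vtx ; edge = edg ; vertex-injective = vtx-inj ; edge-injective = edg-inj ; joins = step }
                refl edg≡g = F.pathPlus _ , F.pathPlus-independent extra , F.pathPlus-size extra
      where
      module F = SpanningPath vtx edg vtx-inj edg-inj step
      g-at-zero : Joins ends g (vtx zero) (vtx (next zero))
      g-at-zero = subst (λ z → Joins ends z (vtx zero) (vtx (next zero))) edg≡g (step zero)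
      g′-at-zero : Joins ends g′ (vtx zero) (vtx (next zero))
      g′-at-zero with joins-endpoints jg g-at-zero
      ... | inj₁ (r₁ , r₂) = subst₂ (Joins ends g′) r₁ r₂ jg′
      ... | inj₂ (r₁ , r₂) = joins-sym (subst₂ (Joins ends g′) r₁ r₂ jg′)
      extra = F.extraParallel (λ r → g≢g′ (trans (sym edg≡g) (sym r))) g′-at-zero

  digon⇒largeIndependent : ∀ {g g′ a b} → g ≢ g′ → a ≢ b → Joins ends g a b → Joins ends g′ a b → LargeIndependent
  digon⇒largeIndependent {g} g≢g′ a≢b jg jg′ with nonLoop-on-longWalk baseWalk (s≤s (s≤s z≤n)) jg a≢b
  ... | t , jt with baseEdge t Fin.≟ g
  ...   | yes base≡g = spanningDigon⇒largeIndependent baseWalk refl g≢g′ jg jg′ t base≡g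
  ...   | no base≢g = spanningDigon⇒largeIndependent (replaceWalkEdge baseWalk t g base≢g′ jt) refl g≢g′ jg jg′ t
                        (replaceAt-here baseEdge t g)
    where
    base≢g′ : ∀ s → baseEdge s ≢ g
    base≢g′ s r = base≢g (trans (cong baseEdge (sym (joins-walk-index baseWalk (s≤s (s≤s z≤n)) {s = s} {t = t}
                    (subst (λ z → Joins ends z (ordering s) (ordering (next s))) r (proj₂ (edgeAt s))) jt))) r)

  shortCycle⇒largeIndependent : ∀ {X} (R : CycleWalk X) → (p R ≡ 0) ⊎ (p R ≡ 1) → LargeIndependent
  shortCycle⇒largeIndependent R (inj₁ one) = loop⇒largeIndependent (one-edge-loop R one)
  shortCycle⇒largeIndependent R (inj₂ two) =
    digon⇒largeIndependent (two-edge-distinct R two) (two-vertex-distinct R two) (joins R zero) (two-edge-parallel R two)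

  ∣short∪short∣≤4 : ∀ {X₁ X₂} (R₁ : CycleWalk X₁) (R₂ : CycleWalk X₂) → (p R₁ ≡ 0) ⊎ (p R₁ ≡ 1) →
                    (p R₂ ≡ 0) ⊎ (p R₂ ≡ 1) → ∣ X₁ ∪ X₂ ∣ ≤ 4
  ∣short∪short∣≤4 {X₁} {X₂} R₁ R₂ short₁ short₂ =
    ≤-trans (∣p∪q∣≤∣p∣+∣q∣ X₁ X₂)
        (+-mono-≤ (≤-trans (walk-size R₁) (s≤s (≤1 short₁))) (≤-trans (walk-size R₂) (s≤s (≤1 short₂))))
    where
    ≤1 : ∀ {k} → (k ≡ 0) ⊎ (k ≡ 1) → k ≤ 1
    ≤1 (inj₁ refl) = z≤n
    ≤1 (inj₂ refl) = s≤s z≤n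

  ¬shortHandcuff : ∀ {X₁ X₂} (R₁ : CycleWalk X₁) (R₂ : CycleWalk X₂) → (p R₁ ≡ 0) ⊎ (p R₁ ≡ 1) →
                   (p R₂ ≡ 0) ⊎ (p R₂ ≡ 1) → ¬ IsCircuitHyperplane ends B (X₁ ∪ X₂)
  ¬shortHandcuff {X₁} {X₂} R₁ R₂ short₁ short₂ (circ , hyper) =
    let I , indI , N<∣I∣ = shortCycle⇒largeIndependent R₁ short₁
    in <⇒≱ (begin-strict
         ∣ X₁ ∪ X₂ ∣   ≤⟨ ∣short∪short∣≤4 R₁ R₂ short₁ short₂ ⟩
         4             <⟨ s≤s (s≤s (s≤s (s≤s (s≤s z≤n)))) ⟩
         suc N         ≤⟨ N<∣I∣ ⟩
         ∣ I ∣         ∎)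
       (circuitHyperplane-maximum circ hyper indI)
    where open Data.Nat.Properties.≤-Reasoning

  ¬meetOnce-spanning : ∀ {X₁ X₂} (R₂ : CycleWalk X₂) → 1 ≤ p R₂ → (∀ x → VertexOf ends X₁ x) → ¬ MeetAtMostOnce X₁ X₂
  ¬meetOnce-spanning R₂ nontrivial spanning meetOnce = walk-step-distinct R₂ nontrivial zero
    (meetOnce _ _ (spanning _) (walk-vertexOf R₂ zero) (spanning _) (walk-vertexOf R₂ (next zero)))

  ¬handcuffCircuitHyperplane : ∀ {X₁ X₂} (R₁ : CycleWalk X₁) (R₂ : CycleWalk X₂) → MeetAtMostOnce X₁ X₂ →
                               ¬ IsCircuitHyperplane ends B (X₁ ∪ X₂)
  ¬handcuffCircuitHyperplane {X₁} {X₂} R₁ R₂ meetOnce ch with ≡0⊎≡1⊎≥2 (p R₁) | ≡0⊎≡1⊎≥2 (p R₂)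
  ... | inj₂ (inj₂ long₁) | inj₂ (inj₂ long₂) =
    ¬meetOnce-spanning R₂ (≤-trans (s≤s z≤n) long₂) (longWalk-spanning R₁ long₁) meetOnce
  ... | inj₂ (inj₂ long₁) | inj₂ (inj₁ two₂) = ¬meetOnce-spanning R₂ (≡1⇒≥1 two₂) (longWalk-spanning R₁ long₁) meetOnce
  ... | inj₂ (inj₁ two₁) | inj₂ (inj₂ long₂) =
    ¬meetOnce-spanning R₁ (≡1⇒≥1 two₁) (longWalk-spanning R₂ long₂) (λ x y x₂ x₁ y₂ y₁ → meetOnce x y x₁ x₂ y₁ y₂)
  ... | inj₂ (inj₂ long₁) | inj₁ one₂ =
    circuitHyperplane-exchange ch (LoopHandcuff.exchanges R₁ long₁ loop (loop∉walk R₁ (≤-trans (s≤s z≤n) long₁) loop)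
      (∪-elim inj₁ (λ h → inj₂ (one-edge-only R₂ one₂ h))) (p⊆p∪q X₂) (x∈p∪q⁺ (inj₂ (edge∈ R₂ zero))))
    where loop = one-edge-loop R₂ one₂
  ... | inj₁ one₁ | inj₂ (inj₂ long₂) =
    circuitHyperplane-exchange ch (LoopHandcuff.exchanges R₂ long₂ loop (loop∉walk R₂ (≤-trans (s≤s z≤n) long₂) loop)
      (∪-elim (λ h → inj₂ (one-edge-only R₁ one₁ h)) inj₁) (q⊆p∪q X₁ X₂) (x∈p∪q⁺ (inj₁ (edge∈ R₁ zero))))
    where loop = one-edge-loop R₁ one₁
  ... | inj₁ one₁ | inj₁ one₂ = ¬shortHandcuff R₁ R₂ (inj₁ one₁) (inj₁ one₂) ch
  ... | inj₁ one₁ | inj₂ (inj₁ two₂) = ¬shortHandcuff R₁ R₂ (inj₁ one₁) (inj₂ two₂) ch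
  ... | inj₂ (inj₁ two₁) | inj₁ one₂ = ¬shortHandcuff R₁ R₂ (inj₂ two₁) (inj₁ one₂) ch
  ... | inj₂ (inj₁ two₁) | inj₂ (inj₁ two₂) = ¬shortHandcuff R₁ R₂ (inj₂ two₁) (inj₂ two₂) ch

  circuitHyperplane⇒balancedCycle : (C : Subset m) → IsCircuitHyperplane ends B C → IsCycle ends C × B C
  circuitHyperplane⇒balancedCycle C ch@((family , _) , _) with family
  ... | inj₁ balancedCycle = balancedCycle
  ... | inj₂ (inj₁ (theta , _)) = ⊥-elim (circuitHyperplane-exchange ch (ThetaCircuit.exchanges (theta-shape theta)))
  ... | inj₂ (inj₂ (_ , _ , (cyc₁ , _) , (cyc₂ , _) , _ , meetOnce , refl)) =
    ⊥-elim (¬handcuffCircuitHyperplane (cycle⇒walk cyc₁) (cycle⇒walk cyc₂) meetOnce ch)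

proposition3p7 : {n m : ℕ} (ends : Fin m → Fin n × Fin n) (B : Subset m → Set) →
    5 ≤ n → InClassGAtLeast3 ends →
    IsLinearClass ends B → (∀ X → B X → IsHamiltonianCycle ends X) →
    (C : Subset m) → IsCircuitHyperplane ends B C →
    IsCycle ends C × B C
proposition3p7 ends B (s≤s (s≤s (s≤s (s≤s (s≤s _))))) (usc , par2) _ hamB C ch =
  ClassGraph.circuitHyperplane⇒balancedCycle ends B usc par2 hamB C ch
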